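{- Let $D\ge2$ be squarefree, $K=\mathbb{Q}(\sqrt D)$, let $i\ge-1$ be odd, $0\le r\le u_{i+2}-1$, and let $j$ be such that $\beta_j=\alpha_{i,r}$. Then \[ p_K(2\beta_j\,|\,\mathcal{I})=\min\{r+1,u_{i+2}-r+1\},\qquad p_K(\beta_j+\beta_{j+1}\,|\,\mathcal{I})=\min\{r+1,u_{i+2}-r\}, \] and \[ p_K(2\beta_j)=\min\{r+2,u_{i+2}-r+2\},\qquad p_K(\beta_j+\beta_{j+1})=\min\{r+2,u_{i+2}-r+1\}. \]
   Context: $\mathcal{O}_K^+$: totally positive integers of $K$. Indecomposable: element of $\mathcal{O}_K^+$ not a sum of two elements of $\mathcal{O}_K^+$. $p_K(\alpha)$ is the number of unordered representations $\alpha=\lambda_1+\dots+\lambda_\ell$ ($\ell\ge1$, $\lambda_i\in\mathcal{O}_K^+$), and $p_K(\alpha\,|\,\mathcal{I})$ the number of those with all $\lambda_i$ indecomposable. Notation: $\omega_D=\sqrt D$, $\xi_D=\sqrt D$ if $D\equiv2,3\pmod4$; $\omega_D=(1+\sqrt D)/2$, $\xi_D=(\sqrt D-1)/2$ if $D\equiv1\pmod4$. Write $\omega_D=[\lceil u_0/2\rceil;\overline{u_1,\dots,u_s}]$ with $u_s=u_0$. Let $p_{ -1}=1,q_{ -1}=0$, $p_0=\lceil u_0/2\rceil,q_0=1$, $p_{i+2}=u_{i+2}p_{i+1}+p_i$, $q_{i+2}=u_{i+2}q_{i+1}+q_i$, $\alpha_i=p_i+q_i\xi_D$, $\alpha_{i,r}=\alpha_i+r\alpha_{i+1}$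 (so $\alpha_{i,u_{i+2}}=\alpha_{i+2,0}$, $\alpha_{ -1,0}=1$). The indecomposables are the $\alpha_{i,r}$ ($i\ge-1$ odd, $0\le r\le u_{i+2}-1$) and their Galois conjugates, ordered as $\dots<\beta_{ -1}<\beta_0=1<\beta_1<\dots$ with $\beta_{ -j}=\beta_j'$; for $j\ge0$, $\beta_j$ runs through the $\alpha_{i,r}$ in lexicographic order of $(i,r)$. -}

module Defs where

open import Data.Bool using (Bool; true; false)
open import Data.Nat as ℕ using (ℕ; zero; suc)
open import Data.Nat.DivMod as ℕD using ()
open import Data.Nat.Divisibility using (_∣_)
open import Data.Integer as ℤ using (ℤ; +_; -[1+_]; _+_; _*_; -_; _-_; _<_; _≤_; _/ℕ_)
open import Data.Product using (Σ; _×_; _,_; ∃)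
open import Data.Sum using (_⊎_)
open import Data.Empty using (⊥)
open import Relation.Nullary using (¬_)
open import Relation.Binary.PropositionalEquality using (_≡_)
open import Data.List using (List; []; _∷_; length; foldr)
open import Data.List.Relation.Unary.All using (All)
open import Data.List.Relation.Unary.Any using (Any)
open import Data.List.Relation.Unary.AllPairs using (AllPairs)
open import Data.List.Relation.Binary.Permutation.Propositional using (_↭_)

SquareFree : ℕ → Set
SquareFree D = ∀ n → n ℕ.* n ∣ D → n ≡ 1

-- The ring of integers O_K = ℤ[ω_D] of K = ℚ(√D), D ≥ 2 squarefree.
-- An element  ⟨ a , b ⟩  stands for  a + b ω_D.

record OK : Set where
  constructor ⟨_,_⟩
  field
    a : ℤ
    b : ℤ
open OK public

-- e D = 1 if D ≡ 1 (mod 4), else 0; so ω_D = (e + √D)/2 or √D.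
e : ℕ → ℤ
e D with D ℕD.% 4
... | suc zero = + 1
... | _        = + 0

0K : OK
0K = ⟨ + 0 , + 0 ⟩

_⊕_ : OK → OK → OK
⟨ a₁ , b₁ ⟩ ⊕ ⟨ a₂ , b₂ ⟩ = ⟨ a₁ + a₂ , b₁ + b₂ ⟩

_⊖_ : OK → OK → OK
⟨ a₁ , b₁ ⟩ ⊖ ⟨ a₂ , b₂ ⟩ = ⟨ a₁ - a₂ , b₁ - b₂ ⟩

scale : ℕ → OK → OK
scale r ⟨ a₁ , b₁ ⟩ = ⟨ + r * a₁ , + r * b₁ ⟩

sumK : List OK → OK
sumK = foldr _⊕_ 0K

-- doubled coordinates: a + b ω_D = (X + Y √D) / 2
X : ℕ → OK → ℤ
X D ⟨ a₁ , b₁ ⟩ = + 2 * a₁ + e D * b₁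

Y : ℕ → OK → ℤ
Y D ⟨ a₁ , b₁ ⟩ = (+ 2 - e D) * b₁

-- PosR D x y  :⇔  the real number x + y √D is > 0   (x, y ∈ ℤ),
-- written out in integer arithmetic.
PosR : ℕ → ℤ → ℤ → Set
PosR D x y =
    (+ 0 ≤ y × + 0 ≤ x × ¬ (x ≡ + 0 × y ≡ + 0))
  ⊎ (+ 0 ≤ y × x < + 0 × x * x < y * y * + D)
  ⊎ (y < + 0 × + 0 < x × y * y * + D < x * x)

-- α > 0 in the real embedding K ⊂ ℝ with √D > 0
Positive : ℕ → OK → Set
Positive D α = PosR D (X D α) (Y D α)

TotPos : ℕ → OK → Set
TotPos D α = PosR D (X D α) (Y D α) × PosR D (X D α) (- Y D α)

_<[_]_ : OK → ℕ → OK → Set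
α <[ D ] β = Positive D (β ⊖ α)

Indec : ℕ → OK → Set
Indec D α = TotPos D α × ¬ (Σ OK λ β → Σ OK λ γ → TotPos D β × TotPos D γ × (β ⊕ γ) ≡ α)

-- Counting unordered representations.
-- HasCount R n : the lists satisfying R, taken up to permutation
-- (i.e. as multisets), form exactly n classes.

HasCount : (List OK → Set) → ℕ → Set
HasCount R n = Σ (List (List OK)) λ L →
    length L ≡ n
  × All R L
  × (∀ xs → R xs → Any (xs ↭_) L)
  × AllPairs (λ xs ys → ¬ (xs ↭ ys)) L

IsRep : ℕ → OK → List OK → Set
IsRep D α xs = 1 ℕ.≤ length xs × All (TotPos D) xs × sumK xs ≡ α

pK : ℕ → OK → ℕ → Set
pK D α n = HasCount (IsRep D α) n

pKI : ℕ → OK → ℕ → Set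
pKI D α n = HasCount (λ xs → IsRep D α xs × All (Indec D) xs) n

-- Continued fraction of ω_D = (P₀ + √D)/Q₀, computed by the standard
-- exact algorithm for quadratic irrationals:
--   a_k = ⌊(P_k + √D)/Q_k⌋ = ⌊(P_k + ⌊√D⌋)/Q_k⌋,
--   P_{k+1} = a_k Q_k − P_k,  Q_{k+1} = (D − P_{k+1}²)/Q_k.

isqrtGo : ℕ → ℕ → ℕ
isqrtGo D zero = 0
isqrtGo D (suc k) with (suc k ℕ.* suc k) ℕ.≤ᵇ D
... | true  = suc k
... | false = isqrtGo D k

isqrt : ℕ → ℕ
isqrt D = isqrtGo D D

-- floor division by a positive integer (0 if divisor is not positive)
divZ : ℤ → ℤ → ℤ
divZ x (+ suc n) = x /ℕ suc n
divZ x _         = + 0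

record CFState : Set where
  constructor st
  field
    P : ℤ
    Q : ℤ

cfState : ℕ → ℕ → CFState
cfState D zero    = st (e D) (+ 1 + e D)
cfState D (suc k) with cfState D k
... | st P Q =
  let a₁ = divZ (P + + isqrt D) Q
      P' = a₁ * Q - P
  in st P' (divZ (+ D - P' * P') Q)

-- k-th partial quotient of ω_D:  ω_D = [a₀; a₁, a₂, …].
-- In the paper's notation a₀ = ⌈u₀/2⌉ and a_k = u_k for k ≥ 1.
cfA : ℕ → ℕ → ℤ
cfA D k with cfState D k
... | st P Q = divZ (P + + isqrt D) Q

u : ℕ → ℕ → ℕ
u D k = ℤ.∣ cfA D k ∣

-- shifted convergents: pS D k = p_{k-1}, qS D k = q_{k-1}
pS : ℕ → ℕ → ℤ
pS D zero = + 1
pS D (suc zero) = cfA D 0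
pS D (suc (suc k)) = + u D (suc k) * pS D (suc k) + pS D k

qS : ℕ → ℕ → ℤ
qS D zero = + 0
qS D (suc zero) = + 1
qS D (suc (suc k)) = + u D (suc k) * qS D (suc k) + qS D k

-- ξ_D = ω_D − e D  (= √D, resp. (√D − 1)/2)
ξ : ℕ → OK
ξ D = ⟨ - e D , + 1 ⟩

-- alphaS D k = α_{k-1} = p_{k-1} + q_{k-1} ξ_D
alphaS : ℕ → ℕ → OK
alphaS D k = ⟨ pS D k - e D * qS D k , qS D k ⟩

-- alphaIR D m r = α_{i,r} = α_i + r α_{i+1}  with i = 2m − 1
alphaIR : ℕ → ℕ → ℕ → OK
alphaIR D m r = alphaS D (2 ℕ.* m) ⊕ scale r (alphaS D (suc (2 ℕ.* m)))

-- β⁺ is the successor of β among the indecomposables in the order of ℝ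
-- (i.e. if β = β_j then β⁺ = β_{j+1})
IsNextIndec : ℕ → OK → OK → Set
IsNextIndec D β β⁺ =
  Indec D β⁺ × β <[ D ] β⁺ ×
  (∀ γ → Indec D γ → β <[ D ] γ → γ <[ D ] β⁺ → ⊥)

{-# OPTIONS --safe #-}

-- Let i be odd, A = α_i, B = α_{i+1} and u = u_{i+2}, so that α_{i,r} = A + r B and
-- α_{i+2} = A + u B. Since p_i q_{i+1} − p_{i+1} q_i = 1, (A, B) is a ℤ-basis of O_K, and the
-- signs A, A′ > 0, B > A, B′ < 0, (A + u B)′ > 0 > (A + (u+1) B)′ force every totally
-- positive x A + y B to have x ≥ 1, with x = 1 only for 0 ≤ y ≤ u. So the A + y B with
-- 0 ≤ y ≤ u are indecomposable, the successor of α_{i,r} is α_{i,r+1}, and a sum of totally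
-- positive elements equal to 2A + nB either has one part or is (A + y₁ B) + (A + y₂ B) with
-- y₁ + y₂ = n. Counting the pairs {y₁, y₂} ⊆ [0, u] with y₁ + y₂ = 2r or 2r + 1 gives the
-- formulas.
--
-- The signs come from the continued fraction of ω_D. With complete quotients (P_k + √D)/Q_k,
-- Q_k α_{k-2} = (√D − P_k) α_{k-1}; taking norms shows that N(α_k) alternates in sign, and
-- since (Q_k − P_k)² < D, N(α_{k-2} + α_{k-1}) has the sign opposite to N(α_{k-1}). An
-- element x + y√D > 0 has positive conjugate exactly when its norm is positive.

module Submission where

open import Defs
open import Data.Nat using (ℕ; suc; _+_; _*_; _∸_; _≤_; _<_; _⊓_)
open import Data.Product using (_×_)

open import Data.Bool using (true; false)
import Data.Bool as Bool
open import Data.Empty using (⊥; ⊥-elim)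
open import Data.Integer as ℤ using (ℤ; +_; -[1+_]; +≤+; +<+; -<+)
import Data.Integer.DivMod as ℤ
import Data.Integer.Properties as ℤ
open import Data.Integer.Tactic.RingSolver as ℤ-Solver using ()
open import Data.List using (List; []; _∷_; length; applyUpTo)
open import Data.List.Membership.Propositional.Properties using (∈-applyUpTo⁺)
open import Data.List.Properties using (length-applyUpTo)
open import Data.List.Relation.Binary.Permutation.Propositional using (_↭_; ↭-refl; ↭-reflexive; ↭-trans; swap)
open import Data.List.Relation.Binary.Permutation.Propositional.Properties using (∈-resp-↭; ↭-length)
open import Data.List.Relation.Unary.All using (All; []; _∷_)
import Data.List.Relation.Unary.All.Properties as All
import Data.List.Relation.Unary.AllPairs.Properties as AllPairs
open import Data.List.Relation.Unary.Any using (here; there)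
import Data.List.Relation.Unary.Any as Any
open import Data.Nat as ℕ using (zero; z≤n; s≤s)
open import Data.Nat.Divisibility using (_∣_; ∣-refl)
import Data.Nat.DivMod as ℕ
import Data.Nat.Properties as ℕ
open import Data.Nat.Tactic.RingSolver as ℕ-Solver using ()
open import Data.Product using (Σ; _,_; proj₁; proj₂)
open import Data.Sum using (_⊎_; inj₁; inj₂)
open import Function using (_∘_)
open import Relation.Binary using (tri<; tri≈; tri>)
open import Relation.Binary.PropositionalEquality
  using (_≡_; refl; sym; trans; cong; cong₂; subst; subst₂; module ≡-Reasoning)
open import Relation.Nullary using (¬_; yes; no; contradiction)

-- Comparing a √c with b √d

record SqrtLess (c d a b : ℕ) : Set where
  constructor sqrtLess
  field
    squares< : a * a * c < b * b * d
open SqrtLess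

sqrtLess-asym : ∀ {c d a b} → SqrtLess c d a b → ¬ SqrtLess d c b a
sqrtLess-asym (sqrtLess p) (sqrtLess q) = ℕ.<-asym p q

square-cancel-≤ : ∀ {m n} → m * m ≤ n * n → m ≤ n
square-cancel-≤ {m} {n} mm≤nn with m ℕ.≤? n
... | yes m≤n = m≤n
... | no  m≰n = contradiction mm≤nn (ℕ.<⇒≱ (ℕ.*-mono-< n<m n<m))
  where n<m = ℕ.≰⇒> m≰n

square-mean-≤ : ∀ c d a b a′ b′ → a * a * c ≤ b * b * d → a′ * a′ * c ≤ b′ * b′ * d →
                a * a′ * c ≤ b * b′ * d
square-mean-≤ c d a b a′ b′ p q = square-cancel-≤ (begin
  (a * a′ * c) * (a * a′ * c) ≡⟨ square-split a a′ c ⟩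
  (a * a * c) * (a′ * a′ * c) ≤⟨ ℕ.*-mono-≤ p q ⟩
  (b * b * d) * (b′ * b′ * d) ≡⟨ square-split b b′ d ⟨
  (b * b′ * d) * (b * b′ * d) ∎)
  where
  open ℕ.≤-Reasoning
  square-split : ∀ a a′ c → (a * a′ * c) * (a * a′ * c) ≡ (a * a * c) * (a′ * a′ * c)
  square-split = ℕ-Solver.solve-∀

sqrt-+-mono-≤-< : ∀ {c d a b a′ b′} → ¬ SqrtLess d c b a → SqrtLess c d a′ b′ →
                  SqrtLess c d (a + a′) (b + b′)
sqrt-+-mono-≤-< {c} {d} {a} {b} {a′} {b′} b≮a (sqrtLess q) = sqrtLess (begin-strict
  (a + a′) * (a + a′) * c                        ≡⟨ square-+ a a′ c ⟩
  a * a * c + 2 * (a * a′ * c) + a′ * a′ * c     <⟨ ℕ.+-mono-≤-< (ℕ.+-mono-≤ a≤b (ℕ.*-monoʳ-≤ 2 mean)) q ⟩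
  b * b * d + 2 * (b * b′ * d) + b′ * b′ * d     ≡⟨ square-+ b b′ d ⟨
  (b + b′) * (b + b′) * d                        ∎)
  where
  open ℕ.≤-Reasoning
  square-+ : ∀ a a′ c → (a + a′) * (a + a′) * c ≡ a * a * c + 2 * (a * a′ * c) + a′ * a′ * c
  square-+ = ℕ-Solver.solve-∀
  a≤b : a * a * c ≤ b * b * d
  a≤b = ℕ.≮⇒≥ (b≮a ∘ sqrtLess)
  mean : a * a′ * c ≤ b * b′ * d
  mean = square-mean-≤ c d a b a′ b′ a≤b (ℕ.<⇒≤ q)

sqrt-+-mono-< : ∀ {c d a b a′ b′} → SqrtLess c d a b → SqrtLess c d a′ b′ →
                SqrtLess c d (a + a′) (b + b′)
sqrt-+-mono-< p = sqrt-+-mono-≤-< (sqrtLess-asym p)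

sqrt-+-cancel-< : ∀ {c d x y a b} → SqrtLess c d (x + a) (y + b) → SqrtLess d c y x →
                  SqrtLess c d a b
sqrt-+-cancel-< {c} {d} {x} {y} {a} {b} p q with a * a * c ℕ.<? b * b * d
... | yes a<b = sqrtLess a<b
... | no  a≮b = contradiction p (sqrtLess-asym
                  (subst₂ (SqrtLess d c) (ℕ.+-comm b y) (ℕ.+-comm a x)
                    (sqrt-+-mono-≤-< (a≮b ∘ squares<) q)))

sqrtLess-mono : ∀ {c d a a′ b b′} → a′ ≤ a → b ≤ b′ → SqrtLess c d a b → SqrtLess c d a′ b′
sqrtLess-mono {c} {d} a′≤a b≤b′ (sqrtLess p) = sqrtLess
  (ℕ.≤-<-trans (ℕ.*-monoˡ-≤ c (ℕ.*-mono-≤ a′≤a a′≤a))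
    (ℕ.<-≤-trans p (ℕ.*-monoˡ-≤ d (ℕ.*-mono-≤ b≤b′ b≤b′))))

sqrtLess⇒0< : ∀ {c d a} b → SqrtLess c d a b → 0 < b
sqrtLess⇒0< zero    (sqrtLess ())
sqrtLess⇒0< (suc b) _ = s≤s z≤n

data Difference (m n : ℕ) : ℤ → Set where
  diff≥ : ∀ k → m ≡ n + k → Difference m n (+ k)
  diff< : ∀ k → n ≡ m + suc k → Difference m n -[1+ k ]

difference : ∀ m n → Difference m n (m ℤ.⊖ n)
difference m       zero    = diff≥ m refl
difference zero    (suc n) = diff< n refl
difference (suc m) (suc n) rewrite ℤ.[1+m]⊖[1+n]≡m⊖n m n with m ℤ.⊖ n | difference m n
... | _ | diff≥ k m≡n+k   = diff≥ k (cong suc m≡n+k)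
... | _ | diff< k n≡m+1+k = diff< k (cong suc n≡m+1+k)

-- x √c + y √d > 0, by the signs of x and y; the first clause presumes c, d ≥ 1.
Pos : ℕ → ℕ → ℤ → ℤ → Set
Pos c d (+ a)    (+ b)    = 1 ≤ a + b
Pos c d -[1+ a ] (+ b)    = SqrtLess c d (suc a) b
Pos c d (+ a)    -[1+ b ] = SqrtLess d c (suc b) a
Pos c d -[1+ _ ] -[1+ _ ] = ⊥

Pos-swap : ∀ {c d} x y → Pos c d x y → Pos d c y x
Pos-swap (+ a)    (+ b)    p = subst (1 ≤_) (ℕ.+-comm a b) p
Pos-swap -[1+ _ ] (+ _)    p = p
Pos-swap (+ _)    -[1+ _ ] p = p

Pos-comm : ∀ {c d} x y x′ y′ → Pos c d (x′ ℤ.+ x) (y′ ℤ.+ y) → Pos c d (x ℤ.+ x′) (y ℤ.+ y′)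
Pos-comm x y x′ y′ = subst₂ (Pos _ _) (ℤ.+-comm x′ x) (ℤ.+-comm y′ y)

-- Qₙ names the quadrant of the summands: Q₁ is x, y ≥ 0; Q₂ is x < 0 ≤ y; Q₄ is y < 0 ≤ x.
private
  Pos-+-Q₁Q₂ : ∀ {c d} a b a′ b′ {z} → Difference a (suc a′) z →
               Pos c d -[1+ a′ ] (+ b′) → Pos c d z (+ (b + b′))
  Pos-+-Q₁Q₂ a b a′ b′ (diff≥ k _) q =
    ℕ.≤-trans (sqrtLess⇒0< b′ q) (ℕ.≤-trans (ℕ.m≤n+m b′ b) (ℕ.m≤n+m _ k))
  Pos-+-Q₁Q₂ a b a′ b′ (diff< k eq) q =
    sqrtLess-mono (subst (suc k ≤_) (sym eq) (ℕ.m≤n+m (suc k) a)) (ℕ.m≤n+m b′ b) q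

  Pos-+-Q₂Q₂ : ∀ {c d} a b a′ b′ → Pos c d -[1+ a ] (+ b) → Pos c d -[1+ a′ ] (+ b′) →
               Pos c d -[1+ suc (a + a′) ] (+ (b + b′))
  Pos-+-Q₂Q₂ {c} {d} a b a′ b′ p q =
    subst (λ t → SqrtLess c d (suc t) (b + b′)) (ℕ.+-suc a a′) (sqrt-+-mono-< p q)

  Pos-+-Q₂Q₄ : ∀ {c d} a b a′ b′ {z w} → Difference a′ (suc a) z → Difference b (suc b′) w →
               Pos c d -[1+ a ] (+ b) → Pos c d (+ a′) -[1+ b′ ] → Pos c d z w
  Pos-+-Q₂Q₄ {c} {d} a b a′ b′ (diff≥ zero a′≡) (diff≥ zero b≡) p q = ⊥-elim (
    sqrtLess-asym (subst (SqrtLess c d (suc a)) (trans b≡ (ℕ.+-identityʳ _)) p)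
                  (subst (SqrtLess d c (suc b′)) (trans a′≡ (ℕ.+-identityʳ _)) q))
  Pos-+-Q₂Q₄ a b a′ b′ (diff≥ (suc k) _) (diff≥ l _) _ _ = s≤s z≤n
  Pos-+-Q₂Q₄ a b a′ b′ (diff≥ zero _) (diff≥ (suc l) _) _ _ = s≤s z≤n
  Pos-+-Q₂Q₄ a b a′ b′ (diff< k a+1≡) (diff< l b′+1≡) p q =
    sqrtLess-asym p (sqrtLess-mono (subst (b ≤_) (sym b′+1≡) (ℕ.m≤m+n b (suc l)))
                                   (subst (a′ ≤_) (sym a+1≡) (ℕ.m≤m+n a′ (suc k))) q)
  Pos-+-Q₂Q₄ {c} {d} a b a′ b′ (diff< k a+1≡) (diff≥ l b≡) p q =
    sqrt-+-cancel-< (subst₂ (SqrtLess c d) a+1≡ b≡ p) q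
  Pos-+-Q₂Q₄ {c} {d} a b a′ b′ (diff≥ k a′≡) (diff< l b′+1≡) p q =
    sqrt-+-cancel-< (subst₂ (SqrtLess d c) b′+1≡ a′≡ q) p

Pos-+ : ∀ {c d} x y x′ y′ → Pos c d x y → Pos c d x′ y′ → Pos c d (x ℤ.+ x′) (y ℤ.+ y′)
Pos-+ (+ a)    (+ b)    (+ a′)    (+ b′)    p q =
  ℕ.≤-trans p (ℕ.+-mono-≤ (ℕ.m≤m+n a a′) (ℕ.m≤m+n b b′))
Pos-+ (+ a)    (+ b)    -[1+ a′ ] (+ b′)    p q = Pos-+-Q₁Q₂ a b a′ b′ (difference a (suc a′)) q
Pos-+ -[1+ a ] (+ b)    (+ a′)    (+ b′)    p q =
  Pos-comm -[1+ a ] (+ b) (+ a′) (+ b′) (Pos-+-Q₁Q₂ a′ b′ a b (difference a′ (suc a)) p)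
Pos-+ -[1+ a ] (+ b)    -[1+ a′ ] (+ b′)    p q = Pos-+-Q₂Q₂ a b a′ b′ p q
Pos-+ -[1+ a ] (+ b)    (+ a′)    -[1+ b′ ] p q =
  Pos-+-Q₂Q₄ a b a′ b′ (difference a′ (suc a)) (difference b (suc b′)) p q
Pos-+ (+ a)    -[1+ b ] -[1+ a′ ] (+ b′)    p q =
  Pos-comm (+ a) -[1+ b ] -[1+ a′ ] (+ b′)
    (Pos-+-Q₂Q₄ a′ b′ a b (difference a (suc a′)) (difference b′ (suc b)) q p)
Pos-+ (+ a)    (+ b)    (+ a′)    -[1+ b′ ] p q =
  Pos-swap (+ b ℤ.+ -[1+ b′ ]) (+ (a + a′))
    (Pos-+-Q₁Q₂ b a b′ a′ (difference b (suc b′)) q)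
Pos-+ (+ a)    -[1+ b ] (+ a′)    (+ b′)    p q =
  Pos-comm (+ a) -[1+ b ] (+ a′) (+ b′)
    (Pos-swap (+ b′ ℤ.+ -[1+ b ]) (+ (a′ + a))
      (Pos-+-Q₁Q₂ b′ a′ b a (difference b′ (suc b)) p))
Pos-+ (+ a)    -[1+ b ] (+ a′)    -[1+ b′ ] p q =
  Pos-swap -[1+ suc (b + b′) ] (+ (a + a′)) (Pos-+-Q₂Q₂ b a b′ a′ p q)

-- Surds x + y √D

Surd : Set
Surd = ℤ × ℤ

infixl 6 _⊞_
infixl 7 _⊛_
infix  8 ⊟_

_⊞_ : Surd → Surd → Surd
(x , y) ⊞ (x′ , y′) = x ℤ.+ x′ , y ℤ.+ y′

_⊛_ : ℤ → Surd → Surd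
k ⊛ (x , y) = k ℤ.* x , k ℤ.* y

⊟_ : Surd → Surd
⊟ (x , y) = ℤ.- x , ℤ.- y

conj : Surd → Surd
conj (x , y) = x , ℤ.- y

⊛-identityˡ : ∀ v → + 1 ⊛ v ≡ v
⊛-identityˡ (x , y) = cong₂ _,_ (ℤ.*-identityˡ x) (ℤ.*-identityˡ y)

⊞-comm : ∀ v w → v ⊞ w ≡ w ⊞ v
⊞-comm (x , y) (x′ , y′) = cong₂ _,_ (ℤ.+-comm x x′) (ℤ.+-comm y y′)

⊛-assoc : ∀ i j v → (i ℤ.* j) ⊛ v ≡ i ⊛ (j ⊛ v)
⊛-assoc i j (x , y) = cong₂ _,_ (ℤ.*-assoc i j x) (ℤ.*-assoc i j y)

⊛-distrib-⊞ : ∀ k v w → k ⊛ (v ⊞ w) ≡ k ⊛ v ⊞ k ⊛ w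
⊛-distrib-⊞ k (x , y) (x′ , y′) = cong₂ _,_ (ℤ.*-distribˡ-+ k x x′) (ℤ.*-distribˡ-+ k y y′)

⊟-comb : ∀ x y v w → ⊟ (x ⊛ v ⊞ y ⊛ w) ≡ (ℤ.- x) ⊛ v ⊞ (ℤ.- y) ⊛ w
⊟-comb x y (v₁ , v₂) (w₁ , w₂) = cong₂ _,_ (neg-comb x y v₁ w₁) (neg-comb x y v₂ w₂)
  where
  neg-comb : ∀ x y v w → ℤ.- (x ℤ.* v ℤ.+ y ℤ.* w) ≡ ℤ.- x ℤ.* v ℤ.+ ℤ.- y ℤ.* w
  neg-comb = ℤ-Solver.solve-∀

neg-⊛ : ∀ x v → (ℤ.- x) ⊛ v ≡ x ⊛ ⊟ v
neg-⊛ x (v₁ , v₂) = cong₂ _,_ (neg-* x v₁) (neg-* x v₂)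
  where
  neg-* : ∀ x v → ℤ.- x ℤ.* v ≡ x ℤ.* ℤ.- v
  neg-* = ℤ-Solver.solve-∀

conj-comb : ∀ x y v w → conj (x ⊛ v ⊞ y ⊛ w) ≡ x ⊛ conj v ⊞ y ⊛ conj w
conj-comb x y (_ , v₂) (_ , w₂) = cong (_ ,_) (neg-comb x y v₂ w₂)
  where
  neg-comb : ∀ x y v w → ℤ.- (x ℤ.* v ℤ.+ y ℤ.* w) ≡ x ℤ.* ℤ.- v ℤ.+ y ℤ.* ℤ.- w
  neg-comb = ℤ-Solver.solve-∀

mul : ℕ → Surd → Surd → Surd
mul D (x , y) (x′ , y′) = x ℤ.* x′ ℤ.+ + D ℤ.* (y ℤ.* y′) , x ℤ.* y′ ℤ.+ y ℤ.* x′

norm : ℕ → Surd → ℤ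
norm D (x , y) = x ℤ.* x ℤ.- + D ℤ.* (y ℤ.* y)

norm-mul : ∀ D v w → norm D (mul D v w) ≡ norm D v ℤ.* norm D w
norm-mul D (x , y) (x′ , y′) = brahmagupta x y x′ y′ (+ D)
  where
  brahmagupta : ∀ x y x′ y′ d → (x ℤ.* x′ ℤ.+ d ℤ.* (y ℤ.* y′)) ℤ.* (x ℤ.* x′ ℤ.+ d ℤ.* (y ℤ.* y′))
                                  ℤ.- d ℤ.* ((x ℤ.* y′ ℤ.+ y ℤ.* x′) ℤ.* (x ℤ.* y′ ℤ.+ y ℤ.* x′))
                                ≡ (x ℤ.* x ℤ.- d ℤ.* (y ℤ.* y)) ℤ.* (x′ ℤ.* x′ ℤ.- d ℤ.* (y′ ℤ.* y′))
  brahmagupta = ℤ-Solver.solve-∀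

norm-⊛ : ∀ D k v → norm D (k ⊛ v) ≡ k ℤ.* k ℤ.* norm D v
norm-⊛ D k (x , y) = homogeneous k x y (+ D)
  where
  homogeneous : ∀ k x y d → k ℤ.* x ℤ.* (k ℤ.* x) ℤ.- d ℤ.* (k ℤ.* y ℤ.* (k ℤ.* y))
                            ≡ k ℤ.* k ℤ.* (x ℤ.* x ℤ.- d ℤ.* (y ℤ.* y))
  homogeneous = ℤ-Solver.solve-∀

IsPos : ℕ → Surd → Set
IsPos D (x , y) = Pos 1 D x y

0ˢ : Surd
0ˢ = + 0 , + 0

NonNeg : ℕ → Surd → Set
NonNeg D v = IsPos D v ⊎ v ≡ 0ˢ

module _ {D : ℕ} where

  IsPos-⊞ : ∀ {v w} → IsPos D v → IsPos D w → IsPos D (v ⊞ w)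
  IsPos-⊞ {x , y} {x′ , y′} = Pos-+ x y x′ y′

  IsPos-⊞-NonNeg : ∀ {v w} → IsPos D v → NonNeg D w → IsPos D (v ⊞ w)
  IsPos-⊞-NonNeg     p (inj₁ q)    = IsPos-⊞ p q
  IsPos-⊞-NonNeg {v} p (inj₂ refl) = subst (IsPos D) (sym (⊞-identityʳ v)) p
    where
    ⊞-identityʳ : ∀ v → v ⊞ 0ˢ ≡ v
    ⊞-identityʳ (x , y) = cong₂ _,_ (ℤ.+-identityʳ x) (ℤ.+-identityʳ y)

  NonNeg-⊞-IsPos : ∀ {v w} → NonNeg D v → IsPos D w → IsPos D (v ⊞ w)
  NonNeg-⊞-IsPos {v} {w} p q = subst (IsPos D) (⊞-comm w v) (IsPos-⊞-NonNeg q p)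

  NonNeg-⊞ : ∀ {v w} → NonNeg D v → NonNeg D w → NonNeg D (v ⊞ w)
  NonNeg-⊞     (inj₁ p)    q = inj₁ (IsPos-⊞-NonNeg p q)
  NonNeg-⊞ {w = w} (inj₂ refl) q = subst (NonNeg D) (sym (⊞-identityˡ w)) q
    where
    ⊞-identityˡ : ∀ v → 0ˢ ⊞ v ≡ v
    ⊞-identityˡ (x , y) = cong₂ _,_ (ℤ.+-identityˡ x) (ℤ.+-identityˡ y)

  IsPos-⊛ : ∀ k {v} → IsPos D v → IsPos D (+ suc k ⊛ v)
  IsPos-⊛ zero    {v} p = subst (IsPos D) (sym (⊛-identityˡ v)) p
  IsPos-⊛ (suc k) {v} p = subst (IsPos D) (sym (⊛-suc v)) (IsPos-⊞ p (IsPos-⊛ k p))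
    where
    ⊛-suc : ∀ v → + suc (suc k) ⊛ v ≡ v ⊞ + suc k ⊛ v
    ⊛-suc (x , y) = cong₂ _,_ (ℤ.suc-* (+ suc k) x) (ℤ.suc-* (+ suc k) y)

  NonNeg-⊛ : ∀ k {v} → IsPos D v → NonNeg D (+ k ⊛ v)
  NonNeg-⊛ zero    p = inj₂ refl
  NonNeg-⊛ (suc k) p = inj₁ (IsPos-⊛ k p)

  IsPos-cone : ∀ m n {v w} → 1 ≤ m + n → IsPos D v → IsPos D w → IsPos D (+ m ⊛ v ⊞ + n ⊛ w)
  IsPos-cone (suc m) n       _ p q = IsPos-⊞-NonNeg (IsPos-⊛ m p) (NonNeg-⊛ n q)
  IsPos-cone zero    (suc n) _ p q = NonNeg-⊞-IsPos (NonNeg-⊛ zero p) (IsPos-⊛ n q)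

  NonNeg-cone : ∀ m n {v w} → IsPos D v → IsPos D w → NonNeg D (+ m ⊛ v ⊞ + n ⊛ w)
  NonNeg-cone m n p q = NonNeg-⊞ (NonNeg-⊛ m p) (NonNeg-⊛ n q)

  IsPos⇒¬NonNeg-⊟ : ∀ {v} → IsPos D v → ¬ NonNeg D (⊟ v)
  IsPos⇒¬NonNeg-⊟ {x , y} p q =
    contradiction (subst (IsPos D) (cong₂ _,_ (ℤ.+-inverseʳ x) (ℤ.+-inverseʳ y)) (IsPos-⊞-NonNeg p q)) λ ()

  private
    square-pos : ∀ b → + b ℤ.* + b ℤ.* + D ≡ + (b * b * D)
    square-pos b = trans (cong (ℤ._* + D) (sym (ℤ.pos-* b b))) (sym (ℤ.pos-* (b * b) D))

    square-lt : ∀ {a b} → SqrtLess 1 D a b → + (a * a) ℤ.< + b ℤ.* + b ℤ.* + D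
    square-lt {a} {b} (sqrtLess p) =
      subst (+ (a * a) ℤ.<_) (sym (square-pos b)) (+<+ (subst (_< b * b * D) (ℕ.*-identityʳ _) p))

    square-gt : ∀ {a b} → SqrtLess D 1 b a → + b ℤ.* + b ℤ.* + D ℤ.< + a ℤ.* + a
    square-gt {a} {b} (sqrtLess p) =
      subst₂ ℤ._<_ (sym (square-pos b)) (ℤ.pos-* a a) (+<+ (subst (b * b * D <_) (ℕ.*-identityʳ _) p))

  IsPos⇒PosR : ∀ x y → IsPos D (x , y) → PosR D x y
  IsPos⇒PosR (+ a) (+ b) p = inj₁ (+≤+ z≤n , +≤+ z≤n , λ { (refl , refl) → contradiction p λ () })
  IsPos⇒PosR -[1+ a ] (+ b) p = inj₂ (inj₁ (+≤+ z≤n , -<+ , square-lt p))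
  IsPos⇒PosR (+ a) -[1+ b ] p = inj₂ (inj₂ (-<+ , +<+ (sqrtLess⇒0< a p) , square-gt p))

  PosR⇒IsPos : ∀ x y → PosR D x y → IsPos D (x , y)
  PosR⇒IsPos (+ zero)  (+ zero)  (inj₁ (_ , _ , ≢0)) = contradiction (refl , refl) ≢0
  PosR⇒IsPos (+ zero)  (+ suc b) (inj₁ _) = s≤s z≤n
  PosR⇒IsPos (+ suc a) (+ b)     (inj₁ _) = s≤s z≤n
  PosR⇒IsPos (+ a) (+ b) (inj₂ (inj₁ (_ , +<+ () , _)))
  PosR⇒IsPos (+ a) (+ b) (inj₂ (inj₂ (+<+ () , _)))
  PosR⇒IsPos -[1+ a ] (+ b) (inj₂ (inj₁ (_ , _ , lt))) with subst (_ ℤ.<_) (square-pos b) lt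
  ... | +<+ p = sqrtLess (subst (_< b * b * D) (sym (ℕ.*-identityʳ _)) p)
  PosR⇒IsPos -[1+ a ] (+ b) (inj₁ (_ , () , _))
  PosR⇒IsPos -[1+ a ] (+ b) (inj₂ (inj₂ (+<+ () , _)))
  PosR⇒IsPos (+ a) -[1+ b ] (inj₂ (inj₂ (_ , _ , lt))) with subst₂ ℤ._<_ (square-pos (suc b)) (sym (ℤ.pos-* a a)) lt
  ... | +<+ p = sqrtLess (subst (suc b * suc b * D <_) (sym (ℕ.*-identityʳ _)) p)
  PosR⇒IsPos (+ a) -[1+ b ] (inj₁ (() , _))
  PosR⇒IsPos (+ a) -[1+ b ] (inj₂ (inj₁ (() , _)))
  PosR⇒IsPos -[1+ a ] -[1+ b ] (inj₁ (() , _))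
  PosR⇒IsPos -[1+ a ] -[1+ b ] (inj₂ (inj₁ (() , _)))
  PosR⇒IsPos -[1+ a ] -[1+ b ] (inj₂ (inj₂ (_ , () , _)))

  private
    0<i-j⇒j<i : ∀ {i j} → + 0 ℤ.< i ℤ.- j → j ℤ.< i
    0<i-j⇒j<i p = ℤ.≰⇒> (λ i≤j → ℤ.<⇒≱ p (ℤ.i≤j⇒i-j≤0 i≤j))

    i-j<0⇒i<j : ∀ {i j} → i ℤ.- j ℤ.< + 0 → i ℤ.< j
    i-j<0⇒i<j p = ℤ.≰⇒> (λ j≤i → ℤ.<⇒≱ p (ℤ.i≤j⇒0≤j-i j≤i))

    square-abs : ∀ x → x ℤ.* x ≡ + (ℤ.∣ x ∣ * ℤ.∣ x ∣)
    square-abs (+ a)    = sym (ℤ.pos-* a a)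
    square-abs -[1+ a ] = refl

    norm-abs : ∀ x y → norm D (x , y) ≡ + (ℤ.∣ x ∣ * ℤ.∣ x ∣) ℤ.- + (ℤ.∣ y ∣ * ℤ.∣ y ∣ * D)
    norm-abs x y = cong₂ ℤ._-_ (square-abs x)
      (trans (cong (+ D ℤ.*_) (square-abs y)) (trans (sym (ℤ.pos-* D _)) (cong +_ (ℕ.*-comm D _))))

    norm>0⇒ : ∀ x y → + 0 ℤ.< norm D (x , y) → SqrtLess D 1 ℤ.∣ y ∣ ℤ.∣ x ∣
    norm>0⇒ x y N>0
      with 0<i-j⇒j<i {+ (ℤ.∣ x ∣ * ℤ.∣ x ∣)} {+ (ℤ.∣ y ∣ * ℤ.∣ y ∣ * D)} (subst (+ 0 ℤ.<_) (norm-abs x y) N>0)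
    ... | +<+ lt = sqrtLess (subst (ℤ.∣ y ∣ * ℤ.∣ y ∣ * D <_) (sym (ℕ.*-identityʳ _)) lt)

    norm<0⇒ : ∀ x y → norm D (x , y) ℤ.< + 0 → SqrtLess 1 D ℤ.∣ x ∣ ℤ.∣ y ∣
    norm<0⇒ x y N<0
      with i-j<0⇒i<j {+ (ℤ.∣ x ∣ * ℤ.∣ x ∣)} {+ (ℤ.∣ y ∣ * ℤ.∣ y ∣ * D)} (subst (ℤ._< + 0) (norm-abs x y) N<0)
    ... | +<+ lt = sqrtLess (subst (_< ℤ.∣ y ∣ * ℤ.∣ y ∣ * D) (sym (ℕ.*-identityʳ _)) lt)

  conj-IsPos : ∀ {v} → IsPos D v → + 0 ℤ.< norm D v → IsPos D (conj v)
  conj-IsPos {+ a      , + zero}   v>0 _   = v>0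
  conj-IsPos {+ a      , + suc b}  _   N>0 = norm>0⇒ (+ a) (+ suc b) N>0
  conj-IsPos { -[1+ a ] , + b }    v>0 N>0 = ⊥-elim (sqrtLess-asym v>0 (norm>0⇒ -[1+ a ] (+ b) N>0))
  conj-IsPos {+ a      , -[1+ b ]} _   _   = ℕ.≤-trans (s≤s z≤n) (ℕ.m≤n+m (suc b) a)

  ⊟conj-IsPos : ∀ {v} → IsPos D v → norm D v ℤ.< + 0 → IsPos D (⊟ conj v)
  ⊟conj-IsPos {+ zero  , + zero}   () _
  ⊟conj-IsPos {+ zero  , + suc b}  _   _   = s≤s z≤n
  ⊟conj-IsPos {+ suc a , + b}      _   N<0 =
    subst (Pos 1 D -[1+ a ]) (sym (ℤ.neg-involutive (+ b))) (norm<0⇒ (+ suc a) (+ b) N<0)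
  ⊟conj-IsPos { -[1+ a ] , + b }   _   _   =
    subst (Pos 1 D (+ suc a)) (sym (ℤ.neg-involutive (+ b))) (s≤s z≤n)
  ⊟conj-IsPos {+ a , -[1+ b ]}     v>0 N<0 = ⊥-elim (sqrtLess-asym v>0 (norm<0⇒ (+ a) -[1+ b ] N<0))

re : ℕ → OK → Surd
re D α = X D α , Y D α

RealPos ConjPos : ℕ → OK → Set
RealPos D α = IsPos D (re D α)
ConjPos D α = IsPos D (conj (re D α))

TotPos⇒ : ∀ {D} α → TotPos D α → RealPos D α × ConjPos D α
TotPos⇒ α (p , p′) = PosR⇒IsPos _ _ p , PosR⇒IsPos _ _ p′

TotPos⇐ : ∀ {D} α → RealPos D α × ConjPos D α → TotPos D α
TotPos⇐ α (p , p′) = IsPos⇒PosR _ _ p , IsPos⇒PosR _ _ p′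

<⇒RealPos : ∀ D α β → α <[ D ] β → RealPos D (β ⊖ α)
<⇒RealPos D α β = PosR⇒IsPos _ _

RealPos⇒< : ∀ D α β → RealPos D (β ⊖ α) → α <[ D ] β
RealPos⇒< D α β = IsPos⇒PosR _ _

re-⊕ : ∀ D α β → re D (α ⊕ β) ≡ re D α ⊞ re D β
re-⊕ D ⟨ p , q ⟩ ⟨ p′ , q′ ⟩ = cong₂ _,_ (X-⊕ p q p′ q′ (e D)) (Y-⊕ q q′ (e D))
  where
  X-⊕ : ∀ p q p′ q′ ε → + 2 ℤ.* (p ℤ.+ p′) ℤ.+ ε ℤ.* (q ℤ.+ q′)
                       ≡ (+ 2 ℤ.* p ℤ.+ ε ℤ.* q) ℤ.+ (+ 2 ℤ.* p′ ℤ.+ ε ℤ.* q′)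
  X-⊕ = ℤ-Solver.solve-∀
  Y-⊕ : ∀ q q′ ε → (+ 2 ℤ.- ε) ℤ.* (q ℤ.+ q′) ≡ (+ 2 ℤ.- ε) ℤ.* q ℤ.+ (+ 2 ℤ.- ε) ℤ.* q′
  Y-⊕ = ℤ-Solver.solve-∀

re-scale : ∀ D n β → re D (scale n β) ≡ + n ⊛ re D β
re-scale D n ⟨ p , q ⟩ = cong₂ _,_ (X-scale (+ n) p q (e D)) (Y-scale (+ n) q (e D))
  where
  X-scale : ∀ n p q ε → + 2 ℤ.* (n ℤ.* p) ℤ.+ ε ℤ.* (n ℤ.* q) ≡ n ℤ.* (+ 2 ℤ.* p ℤ.+ ε ℤ.* q)
  X-scale = ℤ-Solver.solve-∀
  Y-scale : ∀ n q ε → (+ 2 ℤ.- ε) ℤ.* (n ℤ.* q) ≡ n ℤ.* ((+ 2 ℤ.- ε) ℤ.* q)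
  Y-scale = ℤ-Solver.solve-∀

TotPos-⊕ : ∀ {D} α β → TotPos D α → TotPos D β → TotPos D (α ⊕ β)
TotPos-⊕ {D} α β α≫0 β≫0 with TotPos⇒ α α≫0 | TotPos⇒ β β≫0
... | α>0 , α′>0 | β>0 , β′>0 = TotPos⇐ (α ⊕ β)
  ( subst (IsPos D) (sym (re-⊕ D α β)) (IsPos-⊞ α>0 β>0)
  , subst (IsPos D) (sym (trans (cong conj (re-⊕ D α β)) (conj-⊞ (re D α) (re D β)))) (IsPos-⊞ α′>0 β′>0))
  where
  conj-⊞ : ∀ v w → conj (v ⊞ w) ≡ conj v ⊞ conj w
  conj-⊞ (_ , y) (_ , y′) = cong (_ ,_) (ℤ.neg-distrib-+ y y′)

lin : ℤ → ℤ → OK → OK → OK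
lin x y A B = ⟨ x ℤ.* a A ℤ.+ y ℤ.* a B , x ℤ.* b A ℤ.+ y ℤ.* b B ⟩

re-lin : ∀ D x y A B → re D (lin x y A B) ≡ x ⊛ re D A ⊞ y ⊛ re D B
re-lin D x y A B = cong₂ _,_ (X-lin x y (a A) (b A) (a B) (b B) (e D)) (Y-lin x y (b A) (b B) (e D))
  where
  X-lin : ∀ x y a₁ b₁ a₂ b₂ ε → + 2 ℤ.* (x ℤ.* a₁ ℤ.+ y ℤ.* a₂) ℤ.+ ε ℤ.* (x ℤ.* b₁ ℤ.+ y ℤ.* b₂)
                              ≡ x ℤ.* (+ 2 ℤ.* a₁ ℤ.+ ε ℤ.* b₁) ℤ.+ y ℤ.* (+ 2 ℤ.* a₂ ℤ.+ ε ℤ.* b₂)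
  X-lin = ℤ-Solver.solve-∀
  Y-lin : ∀ x y b₁ b₂ ε → (+ 2 ℤ.- ε) ℤ.* (x ℤ.* b₁ ℤ.+ y ℤ.* b₂)
                         ≡ x ℤ.* ((+ 2 ℤ.- ε) ℤ.* b₁) ℤ.+ y ℤ.* ((+ 2 ℤ.- ε) ℤ.* b₂)
  Y-lin = ℤ-Solver.solve-∀

⊕-identityʳ : ∀ α → α ⊕ 0K ≡ α
⊕-identityʳ ⟨ p , q ⟩ = cong₂ ⟨_,_⟩ (ℤ.+-identityʳ p) (ℤ.+-identityʳ q)

⊕-⊖-cancel : ∀ α β → α ⊕ (β ⊖ α) ≡ β
⊕-⊖-cancel ⟨ p , q ⟩ ⟨ p′ , q′ ⟩ = cong₂ ⟨_,_⟩ (cancel p p′) (cancel q q′)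
  where
  cancel : ∀ p p′ → p ℤ.+ (p′ ℤ.- p) ≡ p′
  cancel = ℤ-Solver.solve-∀

-- Integer inequalities by nonnegative certificates

private
  0≤-+ : ∀ {i j} → + 0 ℤ.≤ i → + 0 ℤ.≤ j → + 0 ℤ.≤ i ℤ.+ j
  0≤-+ = ℤ.+-mono-≤

  0≤-* : ∀ {i j} → + 0 ℤ.≤ i → + 0 ℤ.≤ j → + 0 ℤ.≤ i ℤ.* j
  0≤-* {+ m} {+ n} _ _ = subst (+ 0 ℤ.≤_) (ℤ.pos-* m n) (+≤+ z≤n)

  ≤-by : ∀ {i j} z → + 0 ℤ.≤ z → z ≡ j ℤ.- i → i ℤ.≤ j
  ≤-by z 0≤z z≡ = ℤ.0≤i-j⇒j≤i (subst (+ 0 ℤ.≤_) z≡ 0≤z)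

  0≤-of-≤ : ∀ {i j} → i ℤ.≤ j → + 0 ℤ.≤ j ℤ.- i
  0≤-of-≤ = ℤ.i≤j⇒0≤j-i

  0≤-of-< : ∀ {i j} → i ℤ.< j → + 0 ℤ.≤ j ℤ.- i ℤ.- + 1
  0≤-of-< {i} {j} i<j = subst (+ 0 ℤ.≤_) (shift i j) (0≤-of-≤ (ℤ.i<j⇒suc[i]≤j i<j))
    where
    shift : ∀ i j → j ℤ.- (+ 1 ℤ.+ i) ≡ j ℤ.- i ℤ.- + 1
    shift = ℤ-Solver.solve-∀

  0<-of-< : ∀ {i j} → i ℤ.< j → + 0 ℤ.< j ℤ.- i
  0<-of-< i<j = ℤ.suc[i]≤j⇒i<j (≤-by _ (0≤-of-< i<j) refl)

  1≤-factor : ∀ x q → + 1 ℤ.≤ x ℤ.* + suc q → + 1 ℤ.≤ x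
  1≤-factor (+ suc n) _ _        = +≤+ (s≤s z≤n)
  1≤-factor (+ zero)  _ (+≤+ ())
  1≤-factor -[1+ _ ]  _ ()

  1≤⇒suc : ∀ {x} → + 1 ℤ.≤ x → Σ ℕ λ n → x ≡ + suc n
  1≤⇒suc (+≤+ {n = suc n} _) = n , refl

  exact-div : ∀ w q → (w ℤ.* + suc q) ℤ./ℕ suc q ≡ w
  exact-div w q = ℤ.≤-antisym
    (ℤ.*-cancelʳ-≤-pos t w (+ suc q) (ℤ.[n/ℕd]*d≤n (w ℤ.* + suc q) (suc q)))
    (ℤ.≮⇒≥ (λ t<w → ℤ.<⇒≱ w<1+t (ℤ.i<j⇒suc[i]≤j t<w)))
    where
    t = (w ℤ.* + suc q) ℤ./ℕ suc q
    w<1+t : w ℤ.< ℤ.suc t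
    w<1+t = ℤ.*-cancelʳ-<-nonNeg (+ suc q) (ℤ.n<s[n/ℕd]*d (w ℤ.* + suc q) (suc q))

  nonneg-view : ∀ {z} → + 0 ℤ.≤ z → Σ ℕ λ k → z ≡ + k
  nonneg-view (+≤+ {n = k} _) = k , refl

  nonpos-view : ∀ {z} → z ℤ.≤ + 0 → Σ ℕ λ k → z ≡ ℤ.- + k
  nonpos-view {z} z≤0 with nonneg-view (ℤ.neg-mono-≤ z≤0)
  ... | k , -z≡k = k , trans (sym (ℤ.neg-involutive z)) (cong ℤ.-_ -z≡k)

hasCount : ∀ {R : List OK → Set} (f : ℕ → List OK) c →
           (∀ {k} → k < c → R (f k)) →
           (∀ xs → R xs → Σ ℕ λ k → k < c × xs ↭ f k) →
           (∀ {i j} → i < j → j < c → ¬ (f i ↭ f j)) →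
           HasCount R c
hasCount f c sound complete distinct =
  applyUpTo f c , length-applyUpTo f c , All.applyUpTo⁺₁ f c sound ,
  (λ xs Rxs → let k , k<c , xs↭fk = complete xs Rxs in
              Any.map (λ fk≡ → subst (xs ↭_) fk≡ xs↭fk) (∈-applyUpTo⁺ f k<c)) ,
  AllPairs.applyUpTo⁺₁ f c distinct

-- A = α_i and B = α_{i+1} for odd i, u = u_{i+2}, C = A + u B = α_{i+2} and C⁺ = A + (u+1) B.
module Cone (D : ℕ) (A B : OK) (u : ℕ)
  (det≡1  : a A ℤ.* b B ℤ.- a B ℤ.* b A ≡ + 1)
  (A>0    : RealPos D A)
  (A′>0   : ConjPos D A)
  (B>A    : IsPos D (re D B ⊞ ⊟ re D A))
  (B′<0   : IsPos D (⊟ conj (re D B)))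
  (C′>0   : ConjPos D (A ⊕ scale u B))
  (C⁺′<0  : IsPos D (⊟ conj (re D (A ⊕ scale (suc u) B))))
  where

  L : ℤ → ℤ → OK
  L x y = lin x y A B

  elt : ℕ → OK
  elt n = A ⊕ scale n B

  elt≡L : ∀ n → elt n ≡ L (+ 1) (+ n)
  elt≡L n = cong₂ ⟨_,_⟩ (cong (ℤ._+ _) (sym (ℤ.*-identityˡ (a A))))
                        (cong (ℤ._+ _) (sym (ℤ.*-identityˡ (b A))))

  -- coordinates in the basis (A , B), by Cramer's rule
  κ₁ κ₂ : OK → ℤ
  κ₁ γ = a γ ℤ.* b B ℤ.- b γ ℤ.* a B
  κ₂ γ = a A ℤ.* b γ ℤ.- b A ℤ.* a γ

  L-κ : ∀ γ → L (κ₁ γ) (κ₂ γ) ≡ γ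
  L-κ ⟨ g₁ , g₂ ⟩ = cong₂ ⟨_,_⟩ (trans (cramer₁ g₁ g₂ (a A) (b A) (a B) (b B)) (det-scale g₁))
                                (trans (cramer₂ g₁ g₂ (a A) (b A) (a B) (b B)) (det-scale g₂))
    where
    cramer₁ : ∀ g₁ g₂ p₁ q₁ p₂ q₂ → (g₁ ℤ.* q₂ ℤ.- g₂ ℤ.* p₂) ℤ.* p₁ ℤ.+ (p₁ ℤ.* g₂ ℤ.- q₁ ℤ.* g₁) ℤ.* p₂
                                     ≡ g₁ ℤ.* (p₁ ℤ.* q₂ ℤ.- p₂ ℤ.* q₁)
    cramer₁ = ℤ-Solver.solve-∀
    cramer₂ : ∀ g₁ g₂ p₁ q₁ p₂ q₂ → (g₁ ℤ.* q₂ ℤ.- g₂ ℤ.* p₂) ℤ.* q₁ ℤ.+ (p₁ ℤ.* g₂ ℤ.- q₁ ℤ.* g₁) ℤ.* q₂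
                                     ≡ g₂ ℤ.* (p₁ ℤ.* q₂ ℤ.- p₂ ℤ.* q₁)
    cramer₂ = ℤ-Solver.solve-∀
    det-scale : ∀ g → g ℤ.* (a A ℤ.* b B ℤ.- a B ℤ.* b A) ≡ g
    det-scale g = trans (cong (g ℤ.*_) det≡1) (ℤ.*-identityʳ g)

  κ₁-L : ∀ x y → κ₁ (L x y) ≡ x
  κ₁-L x y = trans (expand x y (a A) (b A) (a B) (b B)) (trans (cong (x ℤ.*_) det≡1) (ℤ.*-identityʳ x))
    where
    expand : ∀ x y p₁ q₁ p₂ q₂ → (x ℤ.* p₁ ℤ.+ y ℤ.* p₂) ℤ.* q₂ ℤ.- (x ℤ.* q₁ ℤ.+ y ℤ.* q₂) ℤ.* p₂
                                  ≡ x ℤ.* (p₁ ℤ.* q₂ ℤ.- p₂ ℤ.* q₁)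
    expand = ℤ-Solver.solve-∀

  κ₂-L : ∀ x y → κ₂ (L x y) ≡ y
  κ₂-L x y = trans (expand x y (a A) (b A) (a B) (b B)) (trans (cong (y ℤ.*_) det≡1) (ℤ.*-identityʳ y))
    where
    expand : ∀ x y p₁ q₁ p₂ q₂ → p₁ ℤ.* (x ℤ.* q₁ ℤ.+ y ℤ.* q₂) ℤ.- q₁ ℤ.* (x ℤ.* p₁ ℤ.+ y ℤ.* p₂)
                                  ≡ y ℤ.* (p₁ ℤ.* q₂ ℤ.- p₂ ℤ.* q₁)
    expand = ℤ-Solver.solve-∀

  κ-injective : ∀ β γ → κ₁ β ≡ κ₁ γ → κ₂ β ≡ κ₂ γ → β ≡ γ
  κ-injective β γ κ₁≡ κ₂≡ = trans (sym (L-κ β)) (trans (cong₂ L κ₁≡ κ₂≡) (L-κ γ))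

  κ₁-⊕ : ∀ β γ → κ₁ (β ⊕ γ) ≡ κ₁ β ℤ.+ κ₁ γ
  κ₁-⊕ ⟨ p , q ⟩ ⟨ p′ , q′ ⟩ = additive p q p′ q′ (b B) (a B)
    where
    additive : ∀ p q p′ q′ s t → (p ℤ.+ p′) ℤ.* s ℤ.- (q ℤ.+ q′) ℤ.* t
                                 ≡ (p ℤ.* s ℤ.- q ℤ.* t) ℤ.+ (p′ ℤ.* s ℤ.- q′ ℤ.* t)
    additive = ℤ-Solver.solve-∀

  κ₂-⊕ : ∀ β γ → κ₂ (β ⊕ γ) ≡ κ₂ β ℤ.+ κ₂ γ
  κ₂-⊕ ⟨ p , q ⟩ ⟨ p′ , q′ ⟩ = additive p q p′ q′ (a A) (b A)
    where
    additive : ∀ p q p′ q′ s t → s ℤ.* (q ℤ.+ q′) ℤ.- t ℤ.* (p ℤ.+ p′)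
                                 ≡ (s ℤ.* q ℤ.- t ℤ.* p) ℤ.+ (s ℤ.* q′ ℤ.- t ℤ.* p′)
    additive = ℤ-Solver.solve-∀

  L-⊖ : ∀ x y x′ y′ → L x y ⊖ L x′ y′ ≡ L (x ℤ.- x′) (y ℤ.- y′)
  L-⊖ x y x′ y′ = cong₂ ⟨_,_⟩ (distrib x y x′ y′ (a A) (a B)) (distrib x y x′ y′ (b A) (b B))
    where
    distrib : ∀ x y x′ y′ p q → (x ℤ.* p ℤ.+ y ℤ.* q) ℤ.- (x′ ℤ.* p ℤ.+ y′ ℤ.* q)
                                ≡ (x ℤ.- x′) ℤ.* p ℤ.+ (y ℤ.- y′) ℤ.* q
    distrib = ℤ-Solver.solve-∀

  κ₁-elt : ∀ n → κ₁ (elt n) ≡ + 1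
  κ₁-elt n = trans (cong κ₁ (elt≡L n)) (κ₁-L (+ 1) (+ n))

  κ₂-elt : ∀ n → κ₂ (elt n) ≡ + n
  κ₂-elt n = trans (cong κ₂ (elt≡L n)) (κ₂-L (+ 1) (+ n))

  κ₁-elt-⊕ : ∀ m n → κ₁ (elt m ⊕ elt n) ≡ + 2
  κ₁-elt-⊕ m n = trans (κ₁-⊕ (elt m) (elt n)) (cong₂ ℤ._+_ (κ₁-elt m) (κ₁-elt n))

  κ₂-elt-⊕ : ∀ m n → κ₂ (elt m ⊕ elt n) ≡ + (m + n)
  κ₂-elt-⊕ m n = trans (κ₂-⊕ (elt m) (elt n)) (cong₂ ℤ._+_ (κ₂-elt m) (κ₂-elt n))

  elt-⊕-elt : ∀ {m n m′ n′} → m + n ≡ m′ + n′ → elt m ⊕ elt n ≡ elt m′ ⊕ elt n′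
  elt-⊕-elt {m} {n} {m′} {n′} m+n≡ = κ-injective (elt m ⊕ elt n) (elt m′ ⊕ elt n′)
    (trans (κ₁-elt-⊕ m n) (sym (κ₁-elt-⊕ m′ n′)))
    (trans (κ₂-elt-⊕ m n) (trans (cong +_ m+n≡) (sym (κ₂-elt-⊕ m′ n′))))

  elt-⊖ : ∀ m n → elt n ⊖ elt m ≡ L (+ 0) (n ℤ.⊖ m)
  elt-⊖ m n = trans (cong₂ _⊖_ (elt≡L n) (elt≡L m))
                (trans (L-⊖ (+ 1) (+ n) (+ 1) (+ m)) (cong (L (+ 0)) (ℤ.[+m]-[+n]≡m⊖n n m)))

  private
    v w v′ w′ : Surd
    v  = re D A
    w  = re D B
    v′ = conj v
    w′ = conj w

    re-L : ∀ x y → re D (L x y) ≡ x ⊛ v ⊞ y ⊛ w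
    re-L x y = re-lin D x y A B

    conj-re-L : ∀ x y → conj (re D (L x y)) ≡ x ⊛ v′ ⊞ y ⊛ w′
    conj-re-L x y = trans (cong conj (re-L x y)) (conj-comb x y v w)

    B>0 : IsPos D w
    B>0 = subst (IsPos D) (cong₂ _,_ (cancel (X D A) (X D B)) (cancel (Y D A) (Y D B))) (IsPos-⊞ A>0 B>A)
      where
      cancel : ∀ p q → p ℤ.+ (q ℤ.+ ℤ.- p) ≡ q
      cancel = ℤ-Solver.solve-∀

    conj-re-elt : ∀ n → conj (re D (elt n)) ≡ + 1 ⊛ v′ ⊞ + n ⊛ w′
    conj-re-elt n = trans (cong (conj ∘ re D) (elt≡L n)) (conj-re-L (+ 1) (+ n))

  realPos-L : ∀ m n → 1 ≤ m + n → RealPos D (L (+ m) (+ n))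
  realPos-L m n 1≤m+n = subst (IsPos D) (sym (re-L (+ m) (+ n))) (IsPos-cone m n 1≤m+n A>0 B>0)

  conjPos-L : ∀ m n → ConjPos D (L (+ suc m) (ℤ.- + n))
  conjPos-L m n = subst (IsPos D) (sym (trans (conj-re-L (+ suc m) (ℤ.- + n)) (cong (+ suc m ⊛ v′ ⊞_) (neg-⊛ (+ n) w′))))
                    (IsPos-cone (suc m) n (s≤s z≤n) A′>0 B′<0)

  ¬realPos-L : ∀ m n → ¬ RealPos D (L (ℤ.- + m) (ℤ.- + n))
  ¬realPos-L m n p = IsPos⇒¬NonNeg-⊟ p (subst (NonNeg D) (sym eq) (NonNeg-cone m n A>0 B>0))
    where
    eq : ⊟ re D (L (ℤ.- + m) (ℤ.- + n)) ≡ + m ⊛ v ⊞ + n ⊛ w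
    eq = trans (cong ⊟_ (re-L (ℤ.- + m) (ℤ.- + n))) (trans (⊟-comb (ℤ.- + m) (ℤ.- + n) v w)
           (cong₂ (λ s t → s ⊛ v ⊞ t ⊛ w) (ℤ.neg-involutive (+ m)) (ℤ.neg-involutive (+ n))))

  ¬conjPos-L : ∀ m n → ¬ ConjPos D (L (ℤ.- + m) (+ n))
  ¬conjPos-L m n p = IsPos⇒¬NonNeg-⊟ p (subst (NonNeg D) (sym eq) (NonNeg-cone m n A′>0 B′<0))
    where
    eq : ⊟ conj (re D (L (ℤ.- + m) (+ n))) ≡ + m ⊛ v′ ⊞ + n ⊛ ⊟ w′
    eq = trans (cong ⊟_ (conj-re-L (ℤ.- + m) (+ n))) (trans (⊟-comb (ℤ.- + m) (+ n) v′ w′)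
           (cong₂ _⊞_ (cong (_⊛ v′) (ℤ.neg-involutive (+ m))) (neg-⊛ (+ n) w′)))

  ¬realPos-L-below : ∀ m → ¬ RealPos D (L (+ 1) -[1+ m ])
  ¬realPos-L-below m p =
    IsPos⇒¬NonNeg-⊟ p (inj₁ (subst (IsPos D) (sym eq) (IsPos-⊞-NonNeg B>A (NonNeg-⊛ m B>0))))
    where
    shift : ∀ p q m → ℤ.- (+ 1 ℤ.* p ℤ.+ ℤ.- (+ 1 ℤ.+ m) ℤ.* q) ≡ q ℤ.+ ℤ.- p ℤ.+ m ℤ.* q
    shift = ℤ-Solver.solve-∀
    eq : ⊟ re D (L (+ 1) -[1+ m ]) ≡ w ⊞ ⊟ v ⊞ + m ⊛ w
    eq = trans (cong ⊟_ (re-L (+ 1) -[1+ m ]))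
               (cong₂ _,_ (shift (X D A) (X D B) (+ m)) (shift (Y D A) (Y D B) (+ m)))

  ¬conjPos-L-above : ∀ k → ¬ ConjPos D (L (+ 1) (+ (suc u + k)))
  ¬conjPos-L-above k p =
    IsPos⇒¬NonNeg-⊟ p (inj₁ (subst (IsPos D) (sym eq) (IsPos-⊞-NonNeg C⁺′<0 (NonNeg-⊛ k B′<0))))
    where
    shift : ∀ p q s k → ℤ.- (+ 1 ℤ.* p ℤ.+ (s ℤ.+ k) ℤ.* q) ≡ ℤ.- (+ 1 ℤ.* p ℤ.+ s ℤ.* q) ℤ.+ k ℤ.* ℤ.- q
    shift = ℤ-Solver.solve-∀
    eq : ⊟ conj (re D (L (+ 1) (+ (suc u + k)))) ≡ ⊟ conj (re D (elt (suc u))) ⊞ + k ⊛ ⊟ w′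
    eq = trans (cong ⊟_ (conj-re-L (+ 1) (+ (suc u + k))))
         (trans (cong₂ _,_ (shift (X D A) (X D B) (+ suc u) (+ k))
                           (shift (ℤ.- Y D A) (ℤ.- Y D B) (+ suc u) (+ k)))
                (cong (λ s → ⊟ s ⊞ + k ⊛ ⊟ w′) (sym (conj-re-elt (suc u)))))

  conjPos-L-≤ : ∀ n → n ≤ u → ConjPos D (L (+ 1) (+ n))
  conjPos-L-≤ n n≤u = subst (IsPos D) (sym eq) (IsPos-⊞-NonNeg C′>0 (NonNeg-⊛ k B′<0))
    where
    k = u ∸ n
    shift : ∀ p q n k → + 1 ℤ.* p ℤ.+ n ℤ.* q ≡ + 1 ℤ.* p ℤ.+ (n ℤ.+ k) ℤ.* q ℤ.+ k ℤ.* ℤ.- q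
    shift = ℤ-Solver.solve-∀
    eq : conj (re D (L (+ 1) (+ n))) ≡ conj (re D (elt u)) ⊞ + k ⊛ ⊟ w′
    eq = begin
      conj (re D (L (+ 1) (+ n)))                   ≡⟨ conj-re-L (+ 1) (+ n) ⟩
      + 1 ⊛ v′ ⊞ + n ⊛ w′                           ≡⟨ cong₂ _,_ (shift (X D A) (X D B) (+ n) (+ k))
                                                                 (shift (ℤ.- Y D A) (ℤ.- Y D B) (+ n) (+ k)) ⟩
      + 1 ⊛ v′ ⊞ + (n + k) ⊛ w′ ⊞ + k ⊛ ⊟ w′         ≡⟨ cong (_⊞ + k ⊛ ⊟ w′) (conj-re-elt (n + k)) ⟨
      conj (re D (elt (n + k))) ⊞ + k ⊛ ⊟ w′         ≡⟨ cong (λ t → conj (re D (elt t)) ⊞ + k ⊛ ⊟ w′) (ℕ.m+[n∸m]≡n n≤u) ⟩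
      conj (re D (elt u)) ⊞ + k ⊛ ⊟ w′               ∎
      where open ≡-Reasoning

  TotPosᶜ : ℤ → ℤ → Set
  TotPosᶜ x y = RealPos D (L x y) × ConjPos D (L x y)

  toCoordinates : ∀ γ → TotPos D γ → TotPosᶜ (κ₁ γ) (κ₂ γ)
  toCoordinates γ γ≫0 = subst (λ δ → RealPos D δ × ConjPos D δ) (sym (L-κ γ)) (TotPos⇒ γ γ≫0)

  first-coordinate-pos : ∀ x y → TotPosᶜ x y → + 1 ℤ.≤ x
  first-coordinate-pos (+ suc _) _          _        = +≤+ (s≤s z≤n)
  first-coordinate-pos (+ zero)  (+ n)      (_ , p′) = ⊥-elim (¬conjPos-L 0 n p′)
  first-coordinate-pos (+ zero)  -[1+ n ]   (p , _)  = ⊥-elim (¬realPos-L 0 (suc n) p)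
  first-coordinate-pos -[1+ m ]  (+ n)      (_ , p′) = ⊥-elim (¬conjPos-L (suc m) n p′)
  first-coordinate-pos -[1+ m ]  -[1+ n ]   (p , _)  = ⊥-elim (¬realPos-L (suc m) (suc n) p)

  second-coordinate-bounds : ∀ y → TotPosᶜ (+ 1) y → Σ ℕ λ n → y ≡ + n × n ≤ u
  second-coordinate-bounds -[1+ m ] (p , _) = ⊥-elim (¬realPos-L-below m p)
  second-coordinate-bounds (+ n) (_ , p′) with n ℕ.≤? u
  ... | yes n≤u = n , refl , n≤u
  ... | no  n≰u = ⊥-elim (¬conjPos-L-above (n ∸ suc u)
                    (subst (λ t → ConjPos D (L (+ 1) (+ t))) (sym (ℕ.m+[n∸m]≡n (ℕ.≰⇒> n≰u))) p′))

  κ₁-pos : ∀ γ → TotPos D γ → + 1 ℤ.≤ κ₁ γ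
  κ₁-pos γ γ≫0 = first-coordinate-pos (κ₁ γ) (κ₂ γ) (toCoordinates γ γ≫0)

  κ₁≡1⇒elt : ∀ γ → TotPos D γ → κ₁ γ ≡ + 1 → Σ ℕ λ n → n ≤ u × γ ≡ elt n
  κ₁≡1⇒elt γ γ≫0 κ₁≡1 with second-coordinate-bounds (κ₂ γ)
                              (subst (λ x → TotPosᶜ x (κ₂ γ)) κ₁≡1 (toCoordinates γ γ≫0))
  ... | n , κ₂≡n , n≤u = n , n≤u , (begin
    γ                  ≡⟨ L-κ γ ⟨
    L (κ₁ γ) (κ₂ γ)    ≡⟨ cong₂ L κ₁≡1 κ₂≡n ⟩
    L (+ 1) (+ n)      ≡⟨ elt≡L n ⟨
    elt n              ∎)
    where open ≡-Reasoning

  elt-TotPos : ∀ n → n ≤ u → TotPos D (elt n)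
  elt-TotPos n n≤u = TotPos⇐ (elt n)
    (subst (λ δ → RealPos D δ × ConjPos D δ) (sym (elt≡L n)) (realPos-L 1 n (s≤s z≤n) , conjPos-L-≤ n n≤u))

  elt-Indec : ∀ n → n ≤ u → Indec D (elt n)
  elt-Indec n n≤u = elt-TotPos n n≤u , λ (β , γ , β≫0 , γ≫0 , β⊕γ≡elt) →
    2≰1 (subst (+ 2 ℤ.≤_) (κ₁-sum β γ β⊕γ≡elt) (ℤ.+-mono-≤ (κ₁-pos β β≫0) (κ₁-pos γ γ≫0)))
    where
    2≰1 : ¬ (+ 2 ℤ.≤ + 1)
    2≰1 (+≤+ (s≤s ()))
    κ₁-sum : ∀ β γ → β ⊕ γ ≡ elt n → κ₁ β ℤ.+ κ₁ γ ≡ + 1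
    κ₁-sum β γ β⊕γ≡elt = trans (sym (κ₁-⊕ β γ)) (trans (cong κ₁ β⊕γ≡elt) (κ₁-elt n))

  elt-< : ∀ {m n} → m < n → elt m <[ D ] elt n
  elt-< {m} {n} m<n = RealPos⇒< D (elt m) (elt n) (subst (RealPos D) (sym (elt-⊖ m n))
    (subst (RealPos D ∘ L (+ 0)) (sym (ℤ.⊖-≥ (ℕ.<⇒≤ m<n))) (realPos-L 0 (n ∸ m) (ℕ.m<n⇒0<n∸m m<n))))

  elt-≮ : ∀ {m n} → n ≤ m → ¬ (elt m <[ D ] elt n)
  elt-≮ {m} {n} n≤m m<n = ¬realPos-L 0 (m ∸ n)
    (subst (RealPos D ∘ L (+ 0)) (ℤ.⊖-≤ n≤m) (subst (RealPos D) (elt-⊖ m n) (<⇒RealPos D (elt m) (elt n) m<n)))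

  module _ (r : ℕ) (r<u : r < u) where

    private
      successor-elt : ∀ n → IsNextIndec D (elt r) (elt n) → n ≡ suc r
      successor-elt n (_ , r<n , nothing-between) with ℕ.<-cmp n (suc r)
      ... | tri< n<1+r _ _ = ⊥-elim (elt-≮ (ℕ.≤-pred n<1+r) r<n)
      ... | tri≈ _ n≡1+r _ = n≡1+r
      ... | tri> _ _ 1+r<n = ⊥-elim (nothing-between (elt (suc r)) (elt-Indec (suc r) r<u)
                                       (elt-< (ℕ.n<1+n r)) (elt-< 1+r<n))

      ¬successor-far : ∀ j y → ¬ IsNextIndec D (elt r) (L (+ suc (suc j)) y)
      ¬successor-far j y ((β⁺≫0 , indec) , r<β⁺ , nothing-between) with y ℤ.≤? + r
      ... | yes y≤r = indec (elt r , δ , elt-TotPos r (ℕ.<⇒≤ r<u) , δ≫0 , ⊕-⊖-cancel (elt r) β⁺)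
        where
        β⁺ = L (+ suc (suc j)) y
        δ = β⁺ ⊖ elt r
        δ≡ : δ ≡ L (+ suc j) (y ℤ.- + r)
        δ≡ = trans (cong (β⁺ ⊖_) (elt≡L r)) (L-⊖ (+ suc (suc j)) y (+ 1) (+ r))
        k = proj₁ (nonpos-view (ℤ.i≤j⇒i-j≤0 y≤r))
        δ≫0 : TotPos D δ
        δ≫0 = TotPos⇐ δ (<⇒RealPos D (elt r) β⁺ r<β⁺ , subst (ConjPos D) (sym (trans δ≡ (cong (L (+ suc j))
                 (proj₂ (nonpos-view (ℤ.i≤j⇒i-j≤0 y≤r)))))) (conjPos-L j k))
      ... | no  y≰r = nothing-between (elt (suc r)) (elt-Indec (suc r) r<u) (elt-< (ℕ.n<1+n r))
                        (RealPos⇒< D (elt (suc r)) (L (+ suc (suc j)) y)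
                          (subst (RealPos D) (sym δ≡) (realPos-L (suc j) k (s≤s z≤n))))
        where
        0≤y-1-r : + 0 ℤ.≤ y ℤ.- + suc r
        0≤y-1-r = ℤ.i≤j⇒0≤j-i (ℤ.i<j⇒suc[i]≤j (ℤ.≰⇒> y≰r))
        k = proj₁ (nonneg-view 0≤y-1-r)
        δ≡ : L (+ suc (suc j)) y ⊖ elt (suc r) ≡ L (+ suc j) (+ k)
        δ≡ = trans (cong (L (+ suc (suc j)) y ⊖_) (elt≡L (suc r)))
               (trans (L-⊖ (+ suc (suc j)) y (+ 1) (+ suc r)) (cong (L (+ suc j)) (proj₂ (nonneg-view 0≤y-1-r))))

      successor-coordinates : ∀ x y → IsNextIndec D (elt r) (L x y) → L x y ≡ elt (suc r)
      successor-coordinates x y next@((β⁺≫0 , _) , _) with first-coordinate-pos x y (TotPos⇒ (L x y) β⁺≫0)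
      successor-coordinates (+ zero)        y next | +≤+ ()
      successor-coordinates (+ suc (suc j)) y next | _ = ⊥-elim (¬successor-far j y next)
      successor-coordinates (+ suc zero) y next@((β⁺≫0 , _) , _) | _
        with second-coordinate-bounds y (TotPos⇒ (L (+ 1) y) β⁺≫0)
      ... | n , refl , _ = trans (sym (elt≡L n))
                             (cong elt (successor-elt n (subst (IsNextIndec D (elt r)) (sym (elt≡L n)) next)))

    elt-successor : ∀ β⁺ → IsNextIndec D (elt r) β⁺ → β⁺ ≡ elt (suc r)
    elt-successor β⁺ next = trans (sym (L-κ β⁺))
      (successor-coordinates (κ₁ β⁺) (κ₂ β⁺) (subst (IsNextIndec D (elt r)) (sym (L-κ β⁺)) next))

  κ₁-sumK : ∀ xs → All (TotPos D) xs → + length xs ℤ.≤ κ₁ (sumK xs)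
  κ₁-sumK []       []       = ℤ.≤-refl
  κ₁-sumK (x ∷ xs) (x≫0 ∷ xs≫0) = subst (+ suc (length xs) ℤ.≤_) (sym (κ₁-⊕ x (sumK xs)))
                                     (ℤ.+-mono-≤ (κ₁-pos x x≫0) (κ₁-sumK xs xs≫0))

  private
    both-one : ∀ {i j} → + 1 ℤ.≤ i → + 1 ℤ.≤ j → i ℤ.+ j ≡ + 2 → i ≡ + 1 × j ≡ + 1
    both-one {+ 1}           {+ 1}           _        _        _   = refl , refl
    both-one {+ 1}           {+ suc (suc j)} _        _        ()
    both-one {+ suc (suc i)} {+ suc j}       _        _        i+j≡2 =
      ⊥-elim (ℕ.1+n≢0 (trans (sym (ℕ.+-suc i j)) (ℕ.suc-injective (ℕ.suc-injective (ℤ.+-injective i+j≡2)))))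
    both-one {+ zero}        {_}             (+≤+ ()) _        _
    both-one {+ suc _}       {+ zero}        _        (+≤+ ()) _

    sumK-pair : ∀ x y → sumK (x ∷ y ∷ []) ≡ x ⊕ y
    sumK-pair x y = cong (x ⊕_) (⊕-identityʳ y)

  PairRep : ℕ → List OK → Set
  PairRep n xs = Σ ℕ λ y₁ → Σ ℕ λ y₂ → y₁ ≤ u × y₂ ≤ u × y₁ + y₂ ≡ n × xs ≡ elt y₁ ∷ elt y₂ ∷ []

  -- κ₁ is additive and ≥ 1 on totally positive elements, so a representation of an element
  -- with κ₁ = 2 has at most two parts, each with κ₁ = 1.
  rep-of-κ₁≡2 : ∀ {T n} xs → κ₁ T ≡ + 2 → κ₂ T ≡ + n → IsRep D T xs → xs ≡ T ∷ [] ⊎ PairRep n xs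
  rep-of-κ₁≡2 [] _ _ (() , _)
  rep-of-κ₁≡2 (x ∷ []) _ _ (_ , _ , sum≡T) = inj₁ (cong (_∷ []) (trans (sym (⊕-identityʳ x)) sum≡T))
  rep-of-κ₁≡2 {T} {n} (x ∷ y ∷ []) κ₁≡2 κ₂≡n (_ , x≫0 ∷ y≫0 ∷ [] , sum≡T) =
    inj₂ (n₁ , n₂ , n₁≤u , n₂≤u , ℤ.+-injective n₁+n₂≡n , cong₂ (λ s t → s ∷ t ∷ []) x≡ y≡)
    where
    x⊕y≡T : x ⊕ y ≡ T
    x⊕y≡T = trans (sym (sumK-pair x y)) sum≡T
    κ₁≡1 = both-one (κ₁-pos x x≫0) (κ₁-pos y y≫0) (trans (sym (κ₁-⊕ x y)) (trans (cong κ₁ x⊕y≡T) κ₁≡2))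
    x-part = κ₁≡1⇒elt x x≫0 (proj₁ κ₁≡1)
    y-part = κ₁≡1⇒elt y y≫0 (proj₂ κ₁≡1)
    n₁ = proj₁ x-part
    n₂ = proj₁ y-part
    n₁≤u = proj₁ (proj₂ x-part)
    n₂≤u = proj₁ (proj₂ y-part)
    x≡ = proj₂ (proj₂ x-part)
    y≡ = proj₂ (proj₂ y-part)
    n₁+n₂≡n : + (n₁ + n₂) ≡ + n
    n₁+n₂≡n = trans (sym (κ₂-elt-⊕ n₁ n₂)) (trans (cong κ₂ (trans (sym (cong₂ _⊕_ x≡ y≡)) x⊕y≡T)) κ₂≡n)
  rep-of-κ₁≡2 (x ∷ y ∷ z ∷ xs) κ₁≡2 _ (_ , all≫0 , sum≡T)
    with subst (+ (3 + length xs) ℤ.≤_) (trans (cong κ₁ sum≡T) κ₁≡2) (κ₁-sumK _ all≫0)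
  ... | +≤+ (s≤s (s≤s ()))

  -- T = α_{i,r} + α_{i,s} with s ∈ {r, r + 1}; its two-part representations are
  -- α_{i,r−k} + α_{i,s+k} for k ≤ min(r, u − s).
  module Count (r s : ℕ) (r≤s : r ≤ s) (s≤1+r : s ≤ suc r) (s≤u : s ≤ u) where

    T : OK
    T = elt r ⊕ elt s

    pair : ℕ → List OK
    pair k = elt (r ∸ k) ∷ elt (s + k) ∷ []

    Admissible : ℕ → Set
    Admissible k = k ≤ r ⊓ (u ∸ s)

    private
      r≤u : r ≤ u
      r≤u = ℕ.≤-trans r≤s s≤u

      admissible⇒ : ∀ {k} → Admissible k → k ≤ r × s + k ≤ u
      admissible⇒ {k} k≤ = ℕ.m≤n⊓o⇒m≤n r (u ∸ s) k≤ ,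
        subst (_≤ u) (ℕ.+-comm k s) (ℕ.m≤o∸n⇒m+n≤o k s≤u (ℕ.m≤n⊓o⇒m≤o r (u ∸ s) k≤))

      admissible⇐ : ∀ {k} → k ≤ r → s + k ≤ u → Admissible k
      admissible⇐ {k} k≤r s+k≤u = ℕ.⊓-glb k≤r (ℕ.m+n≤o⇒m≤o∸n k (subst (_≤ u) (ℕ.+-comm s k) s+k≤u))

      pair-sum : ∀ k → k ≤ r → sumK (pair k) ≡ T
      pair-sum k k≤r = trans (cong (elt (r ∸ k) ⊕_) (⊕-identityʳ (elt (s + k))))
                             (elt-⊕-elt {r ∸ k} {s + k} {r} {s} (trans (regroup (r ∸ k) s k) (cong (_+ s) (ℕ.m∸n+n≡m k≤r))))
        where
        regroup : ∀ a s k → a + (s + k) ≡ a + k + s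
        regroup = ℕ-Solver.solve-∀

      T≫0 : TotPos D T
      T≫0 = TotPos-⊕ {D} (elt r) (elt s) (elt-TotPos r r≤u) (elt-TotPos s s≤u)

      pair-IsRep : ∀ {k} → Admissible k → IsRep D T (pair k)
      pair-IsRep {k} adm = s≤s z≤n ,
        elt-TotPos (r ∸ k) (ℕ.≤-trans (ℕ.m∸n≤m r k) r≤u) ∷ elt-TotPos (s + k) (proj₂ (admissible⇒ adm)) ∷ [] ,
        pair-sum k (proj₁ (admissible⇒ adm))

      pair-Indec : ∀ {k} → Admissible k → All (Indec D) (pair k)
      pair-Indec {k} adm =
        elt-Indec (r ∸ k) (ℕ.≤-trans (ℕ.m∸n≤m r k) r≤u) ∷ elt-Indec (s + k) (proj₂ (admissible⇒ adm)) ∷ []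

      other-part : ∀ {y₁ y₂} → y₁ ≤ r → y₁ + y₂ ≡ r + s → y₂ ≡ s + (r ∸ y₁)
      other-part {y₁} {y₂} y₁≤r y₁+y₂≡ = ℕ.+-cancelˡ-≡ y₁ y₂ (s + (r ∸ y₁)) (begin
        y₁ + y₂               ≡⟨ y₁+y₂≡ ⟩
        r + s                 ≡⟨ cong (_+ s) (ℕ.m+[n∸m]≡n y₁≤r) ⟨
        y₁ + (r ∸ y₁) + s     ≡⟨ regroup y₁ (r ∸ y₁) s ⟩
        y₁ + (s + (r ∸ y₁))   ∎)
        where
        open ≡-Reasoning
        regroup : ∀ a b s → a + b + s ≡ a + (s + b)
        regroup = ℕ-Solver.solve-∀

      pair-complete : ∀ xs → PairRep (r + s) xs → Σ ℕ λ k → Admissible k × xs ↭ pair k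
      pair-complete _ (y₁ , y₂ , y₁≤u , y₂≤u , y₁+y₂≡ , refl) with y₁ ℕ.≤? r | y₂ ℕ.≤? r
      ... | yes y₁≤r | _ = r ∸ y₁ , admissible⇐ (ℕ.m∸n≤m r y₁) (subst (_≤ u) y₂≡ y₂≤u) ,
            ↭-reflexive (cong₂ (λ p q → elt p ∷ elt q ∷ []) (sym (ℕ.m∸[m∸n]≡n y₁≤r)) y₂≡)
        where y₂≡ = other-part y₁≤r y₁+y₂≡
      ... | no _ | yes y₂≤r = r ∸ y₂ , admissible⇐ (ℕ.m∸n≤m r y₂) (subst (_≤ u) y₁≡ y₁≤u) ,
            ↭-trans (swap (elt y₁) (elt y₂) ↭-refl)
              (↭-reflexive (cong₂ (λ p q → elt p ∷ elt q ∷ []) (sym (ℕ.m∸[m∸n]≡n y₂≤r)) y₁≡))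
        where y₁≡ = other-part y₂≤r (trans (ℕ.+-comm y₂ y₁) y₁+y₂≡)
      ... | no y₁≰r | no y₂≰r = ⊥-elim (ℕ.<-irrefl refl (begin-strict
        r + s          ≤⟨ ℕ.+-monoʳ-≤ r s≤1+r ⟩
        r + suc r      <⟨ ℕ.+-monoˡ-< (suc r) (ℕ.n<1+n r) ⟩
        suc r + suc r  ≤⟨ ℕ.+-mono-≤ (ℕ.≰⇒> y₁≰r) (ℕ.≰⇒> y₂≰r) ⟩
        y₁ + y₂        ≡⟨ y₁+y₂≡ ⟩
        r + s          ∎))
        where open ℕ.≤-Reasoning

      elt-injective : ∀ {m n} → elt m ≡ elt n → m ≡ n
      elt-injective {m} {n} eq = ℤ.+-injective (trans (sym (κ₂-elt m)) (trans (cong κ₂ eq) (κ₂-elt n)))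

      pair-distinct : ∀ {i j} → i < j → Admissible j → ¬ (pair i ↭ pair j)
      pair-distinct {i} {j} i<j adm p with ∈-resp-↭ p (here refl)
      ... | here eq = ℕ.<⇒≢ i<j (ℕ.∸-cancelˡ-≡ i≤r j≤r (elt-injective eq))
        where
        j≤r = proj₁ (admissible⇒ adm)
        i≤r = ℕ.≤-trans (ℕ.<⇒≤ i<j) j≤r
      ... | there (here eq) = ℕ.<⇒≢ (begin-strict
        r ∸ i  ≤⟨ ℕ.m∸n≤m r i ⟩
        r      ≤⟨ r≤s ⟩
        s      <⟨ ℕ.m<m+n s (ℕ.≤-<-trans z≤n i<j) ⟩
        s + j  ∎) (elt-injective eq)
        where open ℕ.≤-Reasoning

      T-decomposable : ¬ Indec D T
      T-decomposable (_ , indecomposable) =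
        indecomposable (elt r , elt s , elt-TotPos r r≤u , elt-TotPos s s≤u , refl)

    count-Indec : HasCount (λ xs → IsRep D T xs × All (Indec D) xs) (suc (r ⊓ (u ∸ s)))
    count-Indec = hasCount pair (suc (r ⊓ (u ∸ s)))
      (λ k<c → pair-IsRep (ℕ.≤-pred k<c) , pair-Indec (ℕ.≤-pred k<c))
      complete
      (λ i<j j<c → pair-distinct i<j (ℕ.≤-pred j<c))
      where
      complete : ∀ xs → IsRep D T xs × All (Indec D) xs → Σ ℕ λ k → k < suc (r ⊓ (u ∸ s)) × xs ↭ pair k
      complete xs (rep , indec) with rep-of-κ₁≡2 xs (κ₁-elt-⊕ r s) (κ₂-elt-⊕ r s) rep
      complete _ (rep , T-indec ∷ []) | inj₁ refl = ⊥-elim (T-decomposable T-indec)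
      ... | inj₂ pair-rep = let k , adm , xs↭ = pair-complete xs pair-rep in k , s≤s adm , xs↭

    count : HasCount (IsRep D T) (suc (suc (r ⊓ (u ∸ s))))
    count = hasCount rep (suc (suc (r ⊓ (u ∸ s)))) sound complete distinct
      where
      rep : ℕ → List OK
      rep zero    = T ∷ []
      rep (suc k) = pair k
      sound : ∀ {k} → k < suc (suc (r ⊓ (u ∸ s))) → IsRep D T (rep k)
      sound {zero}  _ = s≤s z≤n , T≫0 ∷ [] , ⊕-identityʳ T
      sound {suc k} (s≤s k<c) = pair-IsRep (ℕ.≤-pred k<c)
      complete : ∀ xs → IsRep D T xs → Σ ℕ λ k → k < suc (suc (r ⊓ (u ∸ s))) × xs ↭ rep k
      complete xs isRep with rep-of-κ₁≡2 xs (κ₁-elt-⊕ r s) (κ₂-elt-⊕ r s) isRep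
      ... | inj₁ refl     = zero , s≤s z≤n , ↭-refl
      ... | inj₂ pair-rep = let k , adm , xs↭ = pair-complete xs pair-rep in suc k , s≤s (s≤s adm) , xs↭
      distinct : ∀ {i j} → i < j → j < suc (suc (r ⊓ (u ∸ s))) → ¬ (rep i ↭ rep j)
      distinct {zero}  {suc j} _ _ p = ℕ.1+n≢0 (ℕ.suc-injective (sym (↭-length p)))
      distinct {suc i} {suc j} (s≤s i<j) (s≤s j<c) = pair-distinct i<j (ℕ.≤-pred j<c)

isqrtGo-lower : ∀ D k → isqrtGo D k * isqrtGo D k ≤ D
isqrtGo-lower D zero    = z≤n
isqrtGo-lower D (suc k) with suc k * suc k ℕ.≤ᵇ D in eq
... | true  = ℕ.≤ᵇ⇒≤ (suc k * suc k) D (subst Bool.T (sym eq) _)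
... | false = isqrtGo-lower D k

isqrtGo-upper : ∀ D k j → isqrtGo D k < j → j ≤ k → D < j * j
isqrtGo-upper D zero    j r<j z≤n = ⊥-elim (ℕ.n≮0 r<j)
isqrtGo-upper D (suc k) j r<j j≤1+k with suc k * suc k ℕ.≤ᵇ D in eq
... | true  = ⊥-elim (ℕ.<-irrefl refl (ℕ.<-≤-trans r<j j≤1+k))
... | false with j ℕ.≟ suc k
...   | yes refl = ℕ.≰⇒> (λ j*j≤D → subst Bool.T eq (ℕ.≤⇒≤ᵇ j*j≤D))
...   | no  j≢1+k = isqrtGo-upper D k j r<j (ℕ.≤-pred (ℕ.≤∧≢⇒< j≤1+k j≢1+k))

isqrt-lower : ∀ D → isqrt D * isqrt D ≤ D
isqrt-lower D = isqrtGo-lower D D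

isqrt-upper : ∀ D → D < suc (isqrt D) * suc (isqrt D)
isqrt-upper D with suc (isqrt D) ℕ.≤? D
... | yes 1+r≤D = isqrtGo-upper D D (suc (isqrt D)) ℕ.≤-refl 1+r≤D
... | no  1+r≰D = ℕ.<-≤-trans (ℕ.≰⇒> 1+r≰D) (ℕ.m≤m*n (suc (isqrt D)) (suc (isqrt D)))

isqrt-nonsquare : ∀ D → 2 ≤ D → SquareFree D → isqrt D * isqrt D < D
isqrt-nonsquare D 2≤D sf with ℕ.m≤n⇒m<n∨m≡n (isqrt-lower D)
... | inj₁ r*r<D = r*r<D
... | inj₂ r*r≡D = contradiction (subst (2 ≤_) (trans (sym r*r≡D) (cong (λ t → t * t) r≡1)) 2≤D) λ { (s≤s ()) }
  where
  r≡1 : isqrt D ≡ 1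
  r≡1 = sf (isqrt D) (subst (isqrt D * isqrt D ∣_) r*r≡D ∣-refl)

isqrt-pos : ∀ D → 2 ≤ D → 1 ≤ isqrt D
isqrt-pos D 2≤D with isqrt D | isqrt-upper D
... | suc _ | _       = s≤s z≤n
... | zero  | D<1 = contradiction (ℕ.≤-<-trans 2≤D D<1) λ { (s≤s ()) }

alphaS-rec : ∀ D k → alphaS D (suc (suc k)) ≡ alphaS D k ⊕ scale (u D (suc k)) (alphaS D (suc k))
alphaS-rec D k = cong₂ ⟨_,_⟩ (first (+ u D (suc k)) (pS D (suc k)) (pS D k) (qS D (suc k)) (qS D k) (e D))
                             (second (+ u D (suc k)) (qS D (suc k)) (qS D k))
  where
  first : ∀ c p₁ p₀ q₁ q₀ ε → c ℤ.* p₁ ℤ.+ p₀ ℤ.- ε ℤ.* (c ℤ.* q₁ ℤ.+ q₀)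
                              ≡ p₀ ℤ.- ε ℤ.* q₀ ℤ.+ c ℤ.* (p₁ ℤ.- ε ℤ.* q₁)
  first = ℤ-Solver.solve-∀
  second : ∀ c q₁ q₀ → c ℤ.* q₁ ℤ.+ q₀ ≡ q₀ ℤ.+ c ℤ.* q₁
  second = ℤ-Solver.solve-∀

module ContinuedFraction (D : ℕ) (2≤D : 2 ≤ D) (sf : SquareFree D) where

  g : ℕ
  g = isqrt D

  G : ℤ
  G = + g

  private
    0≤D-g²-1 : + 0 ℤ.≤ + D ℤ.- G ℤ.* G ℤ.- + 1
    0≤D-g²-1 = subst (λ t → + 0 ℤ.≤ + D ℤ.- t ℤ.- + 1) (ℤ.pos-* g g) (0≤-of-< (+<+ (isqrt-nonsquare D 2≤D sf)))

    0≤[g+1]²-D-1 : + 0 ℤ.≤ (G ℤ.+ + 1) ℤ.* (G ℤ.+ + 1) ℤ.- + D ℤ.- + 1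
    0≤[g+1]²-D-1 = subst (λ t → + 0 ℤ.≤ t ℤ.- + D ℤ.- + 1) (trans (ℤ.pos-* (suc g) (suc g))
                     (cong₂ ℤ._*_ (ℤ.+-comm (+ 1) G) (ℤ.+-comm (+ 1) G))) (0≤-of-< (+<+ (isqrt-upper D)))

  small-square : ∀ z → ℤ.- G ℤ.≤ z → z ℤ.≤ G → z ℤ.* z ℤ.< + D
  small-square z -G≤z z≤G = ℤ.suc[i]≤j⇒i<j (≤-by _ (0≤-+ 0≤D-g²-1 (0≤-* (0≤-of-≤ z≤G) (0≤-of-≤ -G≤z)))
                              (certificate (+ D) G z))
    where
    certificate : ∀ d g z → d ℤ.- g ℤ.* g ℤ.- + 1 ℤ.+ (g ℤ.- z) ℤ.* (z ℤ.- ℤ.- g) ≡ d ℤ.- (+ 1 ℤ.+ z ℤ.* z)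
    certificate = ℤ-Solver.solve-∀

  record Invariant (P Q : ℤ) : Set where
    field
      Q≡1+q  : Σ ℕ λ q → Q ≡ + suc q
      P≤G    : P ℤ.≤ G
      Q≤P+G  : Q ℤ.≤ P ℤ.+ G
      Q∣D-P² : Σ ℤ λ t → + D ℤ.- P ℤ.* P ≡ t ℤ.* Q

  -- one step of cfState; P (suc k) and Q (suc k) below unfold to next-P and next-Q
  next-a next-P next-Q : ℤ → ℤ → ℤ
  next-a P Q = divZ (P ℤ.+ G) Q
  next-P P Q = next-a P Q ℤ.* Q ℤ.- P
  next-Q P Q = divZ (+ D ℤ.- next-P P Q ℤ.* next-P P Q) Q

  module Step {P : ℤ} {q : ℕ} (P≤G : P ℤ.≤ G) (Q≤P+G : + suc q ℤ.≤ P ℤ.+ G)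
              (t : ℤ) (D-P²≡ : + D ℤ.- P ℤ.* P ≡ t ℤ.* + suc q) where

    private
      Q ā P′ : ℤ
      Q  = + suc q
      ā  = next-a P Q
      P′ = next-P P Q

      āQ≤P+G : ā ℤ.* Q ℤ.≤ P ℤ.+ G
      āQ≤P+G = ℤ.[n/ℕd]*d≤n (P ℤ.+ G) (suc q)

      0≤[1+ā]Q-P-G-1 : + 0 ℤ.≤ (+ 1 ℤ.+ ā) ℤ.* Q ℤ.- (P ℤ.+ G) ℤ.- + 1
      0≤[1+ā]Q-P-G-1 = 0≤-of-< (ℤ.n<s[n/ℕd]*d (P ℤ.+ G) (suc q))

    ā≥1 : + 1 ℤ.≤ ā
    ā≥1 = 1≤-factor ā q (≤-by _ (0≤-+ 0≤[1+ā]Q-P-G-1 (0≤-of-≤ Q≤P+G)) (certificate ā Q P G))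
      where
      certificate : ∀ ā Q P G → (+ 1 ℤ.+ ā) ℤ.* Q ℤ.- (P ℤ.+ G) ℤ.- + 1 ℤ.+ (P ℤ.+ G ℤ.- Q) ≡ ā ℤ.* Q ℤ.- + 1
      certificate = ℤ-Solver.solve-∀

    P′≤G : P′ ℤ.≤ G
    P′≤G = ≤-by _ (0≤-of-≤ āQ≤P+G) (certificate ā Q P G)
      where
      certificate : ∀ ā Q P G → P ℤ.+ G ℤ.- ā ℤ.* Q ≡ G ℤ.- (ā ℤ.* Q ℤ.- P)
      certificate = ℤ-Solver.solve-∀

    1-G≤P′ : + 1 ℤ.- G ℤ.≤ P′
    1-G≤P′ = ≤-by _ (0≤-+ (0≤-+ 0≤[1+ā]Q-P-G-1 (0≤-of-≤ Q≤P+G)) (0≤-of-≤ P≤G)) (certificate ā Q P G)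
      where
      certificate : ∀ ā Q P G → (+ 1 ℤ.+ ā) ℤ.* Q ℤ.- (P ℤ.+ G) ℤ.- + 1 ℤ.+ (P ℤ.+ G ℤ.- Q) ℤ.+ (G ℤ.- P)
                                ≡ (ā ℤ.* Q ℤ.- P) ℤ.- (+ 1 ℤ.- G)
      certificate = ℤ-Solver.solve-∀

    -- D − P′² = (D − P²) + (P − P′)(P + P′), and P + P′ = ā Q
    Q′-witness : ℤ
    Q′-witness = t ℤ.+ (P ℤ.- P′) ℤ.* ā

    D-P′²≡ : + D ℤ.- P′ ℤ.* P′ ≡ Q′-witness ℤ.* Q
    D-P′²≡ = begin
      + D ℤ.- P′ ℤ.* P′                                 ≡⟨ split (+ D) P ā Q ⟩
      (+ D ℤ.- P ℤ.* P) ℤ.+ (P ℤ.- P′) ℤ.* ā ℤ.* Q      ≡⟨ cong (ℤ._+ (P ℤ.- P′) ℤ.* ā ℤ.* Q) D-P²≡ ⟩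
      t ℤ.* Q ℤ.+ (P ℤ.- P′) ℤ.* ā ℤ.* Q                ≡⟨ ℤ.*-distribʳ-+ Q t ((P ℤ.- P′) ℤ.* ā) ⟨
      Q′-witness ℤ.* Q                                  ∎
      where
      open ≡-Reasoning
      split : ∀ d P ā Q → d ℤ.- (ā ℤ.* Q ℤ.- P) ℤ.* (ā ℤ.* Q ℤ.- P)
                          ≡ (d ℤ.- P ℤ.* P) ℤ.+ (P ℤ.- (ā ℤ.* Q ℤ.- P)) ℤ.* ā ℤ.* Q
      split = ℤ-Solver.solve-∀

    Q′ : ℤ
    Q′ = next-Q P Q

    Q′≡witness : Q′ ≡ Q′-witness
    Q′≡witness = trans (cong (ℤ._/ℕ suc q) D-P′²≡) (exact-div Q′-witness q)

    QQ′≡D-P′² : Q ℤ.* Q′ ≡ + D ℤ.- P′ ℤ.* P′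
    QQ′≡D-P′² = trans (cong (Q ℤ.*_) Q′≡witness) (trans (ℤ.*-comm Q Q′-witness) (sym D-P′²≡))

    private
      -G≤P′ : ℤ.- G ℤ.≤ P′
      -G≤P′ = ℤ.≤-trans (≤-by (+ 1) (+≤+ z≤n) (certificate G)) 1-G≤P′
        where
        certificate : ∀ g → + 1 ≡ + 1 ℤ.- g ℤ.- ℤ.- g
        certificate = ℤ-Solver.solve-∀

    Q′≥1 : + 1 ℤ.≤ Q′
    Q′≥1 = subst (+ 1 ℤ.≤_) (sym Q′≡witness) (1≤-factor Q′-witness q
             (subst (+ 1 ℤ.≤_) D-P′²≡ (≤-by _ (0≤-of-< (small-square P′ -G≤P′ P′≤G)) refl)))

    -- Q ≥ G + 1 − P′ and (G + 1)² > D make Q Q′ > D − P′² if Q′ > P′ + G.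
    Q′≤P′+G : Q′ ℤ.≤ P′ ℤ.+ G
    Q′≤P′+G = ℤ.≮⇒≥ λ P′+G<Q′ → contradiction (S≥0 P′+G<Q′) (λ S≥0 → 0≰-1 (subst (+ 0 ℤ.≤_) S≡-1 S≥0))
      where
      0≰-1 : ¬ (+ 0 ℤ.≤ -[1+ 0 ])
      0≰-1 ()
      S : ℤ
      S = Q ℤ.* (Q′ ℤ.- (P′ ℤ.+ G) ℤ.- + 1) ℤ.+ (Q ℤ.- (G ℤ.+ + 1 ℤ.- P′)) ℤ.* (P′ ℤ.- (+ 1 ℤ.- G) ℤ.+ + 2)
          ℤ.+ ((G ℤ.+ + 1) ℤ.* (G ℤ.+ + 1) ℤ.- + D ℤ.- + 1)
      S≥0 : P′ ℤ.+ G ℤ.< Q′ → + 0 ℤ.≤ S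
      S≥0 P′+G<Q′ = 0≤-+ (0≤-+ (0≤-* (+≤+ (z≤n {suc q})) (0≤-of-< P′+G<Q′))
                               (0≤-* (subst (+ 0 ℤ.≤_) (certificate ā Q P G) 0≤[1+ā]Q-P-G-1)
                                     (0≤-+ (0≤-of-≤ 1-G≤P′) (+≤+ (z≤n {2})))))
                         0≤[g+1]²-D-1
        where
        certificate : ∀ ā Q P G → (+ 1 ℤ.+ ā) ℤ.* Q ℤ.- (P ℤ.+ G) ℤ.- + 1 ≡ Q ℤ.- (G ℤ.+ + 1 ℤ.- (ā ℤ.* Q ℤ.- P))
        certificate = ℤ-Solver.solve-∀
      S≡-1 : S ≡ -[1+ 0 ]
      S≡-1 = begin
        S                                           ≡⟨ expand Q Q′ P′ G (+ D) ⟩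
        Q ℤ.* Q′ ℤ.+ P′ ℤ.* P′ ℤ.- + D ℤ.- + 1     ≡⟨ cong (λ t → t ℤ.+ P′ ℤ.* P′ ℤ.- + D ℤ.- + 1) QQ′≡D-P′² ⟩
        + D ℤ.- P′ ℤ.* P′ ℤ.+ P′ ℤ.* P′ ℤ.- + D ℤ.- + 1 ≡⟨ collapse (+ D) P′ ⟩
        -[1+ 0 ]                                    ∎
        where
        open ≡-Reasoning
        expand : ∀ Q Q′ p G d → Q ℤ.* (Q′ ℤ.- (p ℤ.+ G) ℤ.- + 1)
                                  ℤ.+ (Q ℤ.- (G ℤ.+ + 1 ℤ.- p)) ℤ.* (p ℤ.- (+ 1 ℤ.- G) ℤ.+ + 2)
                                  ℤ.+ ((G ℤ.+ + 1) ℤ.* (G ℤ.+ + 1) ℤ.- d ℤ.- + 1)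
                                ≡ Q ℤ.* Q′ ℤ.+ p ℤ.* p ℤ.- d ℤ.- + 1
        expand = ℤ-Solver.solve-∀
        collapse : ∀ d p → d ℤ.- p ℤ.* p ℤ.+ p ℤ.* p ℤ.- d ℤ.- + 1 ≡ -[1+ 0 ]
        collapse = ℤ-Solver.solve-∀

  step : ∀ {P Q} → Invariant P Q → Invariant (next-P P Q) (next-Q P Q)
  step record { Q≡1+q = q , refl ; P≤G = P≤G ; Q≤P+G = Q≤P+G ; Q∣D-P² = t , D-P²≡ } = record
    { Q≡1+q  = 1≤⇒suc S.Q′≥1
    ; P≤G    = S.P′≤G
    ; Q≤P+G  = S.Q′≤P′+G
    ; Q∣D-P² = + suc q , sym S.QQ′≡D-P′²
    }
    where module S = Step P≤G Q≤P+G t D-P²≡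

  step-a≥1 : ∀ {P Q} → Invariant P Q → + 1 ℤ.≤ next-a P Q
  step-a≥1 record { Q≡1+q = q , refl ; P≤G = P≤G ; Q≤P+G = Q≤P+G ; Q∣D-P² = t , D-P²≡ } =
    Step.ā≥1 P≤G Q≤P+G t D-P²≡

  step-norm : ∀ {P Q} → Invariant P Q → Q ℤ.* next-Q P Q ≡ + D ℤ.- next-P P Q ℤ.* next-P P Q
  step-norm record { Q≡1+q = q , refl ; P≤G = P≤G ; Q≤P+G = Q≤P+G ; Q∣D-P² = t , D-P²≡ } =
    Step.QQ′≡D-P′² P≤G Q≤P+G t D-P²≡

  P Q : ℕ → ℤ
  P k = CFState.P (cfState D k)
  Q k = CFState.Q (cfState D k)

  private
    e-cases : (e D ≡ + 0) ⊎ (e D ≡ + 1 × D ℕ.% 4 ≡ 1)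
    e-cases with D ℕ.% 4 in eq
    ... | 0           = inj₁ refl
    ... | 1           = inj₂ (refl , refl)
    ... | suc (suc _) = inj₁ refl

    g≥1 : 1 ≤ g
    g≥1 = isqrt-pos D 2≤D

  initial : Invariant (P 0) (Q 0)
  initial with e-cases
  ... | inj₁ e≡0 rewrite e≡0 = record
    { Q≡1+q = 0 , refl ; P≤G = +≤+ z≤n ; Q≤P+G = +≤+ g≥1 ; Q∣D-P² = + D , D≡D*1 (+ D) }
    where
    D≡D*1 : ∀ d → d ℤ.- + 0 ℤ.* + 0 ≡ d ℤ.* (+ 1 ℤ.+ + 0)
    D≡D*1 = ℤ-Solver.solve-∀
  ... | inj₂ (e≡1 , D%4≡1) rewrite e≡1 = record
    { Q≡1+q = 1 , refl ; P≤G = +≤+ g≥1 ; Q≤P+G = +≤+ (s≤s g≥1) ; Q∣D-P² = + (2 * (D ℕ./ 4)) , D-1≡ }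
    where
    D≡1+4k : + D ≡ + 1 ℤ.+ + (D ℕ./ 4) ℤ.* + 4
    D≡1+4k = trans (cong +_ (trans (ℕ.m≡m%n+[m/n]*n D 4) (cong (ℕ._+ (D ℕ./ 4) * 4) D%4≡1)))
                   (cong (λ t → + 1 ℤ.+ t) (ℤ.pos-* (D ℕ./ 4) 4))
    D-1≡ : + D ℤ.- + 1 ℤ.* + 1 ≡ + (2 * (D ℕ./ 4)) ℤ.* (+ 1 ℤ.+ + 1)
    D-1≡ = trans (cong (λ d → d ℤ.- + 1 ℤ.* + 1) D≡1+4k)
                 (trans (halve (+ (D ℕ./ 4))) (cong (ℤ._* (+ 1 ℤ.+ + 1)) (sym (ℤ.pos-* 2 (D ℕ./ 4)))))
      where
      halve : ∀ k → + 1 ℤ.+ k ℤ.* + 4 ℤ.- + 1 ℤ.* + 1 ≡ + 2 ℤ.* k ℤ.* (+ 1 ℤ.+ + 1)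
      halve = ℤ-Solver.solve-∀

  invariant : ∀ k → Invariant (P k) (Q k)
  invariant zero    = initial
  invariant (suc k) = step (invariant k)

  a≥1 : ∀ k → + 1 ℤ.≤ cfA D k
  a≥1 k = step-a≥1 (invariant k)

  Q-step : ∀ k → Q k ℤ.* Q (suc k) ≡ + D ℤ.- P (suc k) ℤ.* P (suc k)
  Q-step k = step-norm (invariant k)

  u≡a : ∀ k → + u D k ≡ cfA D k
  u≡a k = ℤ.0≤i⇒+∣i∣≡i (ℤ.≤-trans (+≤+ z≤n) (a≥1 k))

  Q-cancel : ∀ k {x y} → Q k ℤ.* x ≡ Q k ℤ.* y → x ≡ y
  Q-cancel k {x} {y} eq with Invariant.Q≡1+q (invariant k)
  ... | q , Qk≡1+q = ℤ.*-cancelˡ-≡ (+ suc q) x y (subst (λ z → z ℤ.* x ≡ z ℤ.* y) Qk≡1+q eq)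

  Q-⊛-cancel : ∀ k {v w} → Q k ⊛ v ≡ Q k ⊛ w → v ≡ w
  Q-⊛-cancel k {x , y} {x′ , y′} eq = cong₂ _,_ (Q-cancel k (cong proj₁ eq)) (Q-cancel k (cong proj₂ eq))

  private
    e-idempotent : e D ℤ.* e D ≡ e D
    e-idempotent with e-cases
    ... | inj₁ e≡0       rewrite e≡0 = refl
    ... | inj₂ (e≡1 , _) rewrite e≡1 = refl

  -- α k = α_{k-2} in the paper's indexing, with α_{-2} = ξ_D
  α : ℕ → OK
  α zero    = ξ D
  α (suc k) = alphaS D k

  V : ℕ → Surd
  V k = re D (α k)

  V-rec : ∀ k → V (suc (suc k)) ≡ cfA D k ⊛ V (suc k) ⊞ V k
  V-rec zero = cong₂ _,_ (X-rec (cfA D 0) (e D)) (Y-rec (cfA D 0) (e D))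
    where
    X-rec : ∀ a ε → + 2 ℤ.* (a ℤ.- ε ℤ.* + 1) ℤ.+ ε ℤ.* + 1
                  ≡ a ℤ.* (+ 2 ℤ.* (+ 1 ℤ.- ε ℤ.* + 0) ℤ.+ ε ℤ.* + 0) ℤ.+ (+ 2 ℤ.* ℤ.- ε ℤ.+ ε ℤ.* + 1)
    X-rec = ℤ-Solver.solve-∀
    Y-rec : ∀ a ε → (+ 2 ℤ.- ε) ℤ.* + 1 ≡ a ℤ.* ((+ 2 ℤ.- ε) ℤ.* + 0) ℤ.+ (+ 2 ℤ.- ε) ℤ.* + 1
    Y-rec = ℤ-Solver.solve-∀
  V-rec (suc k) = begin
    re D (alphaS D (suc (suc k)))                     ≡⟨ cong (re D) (alphaS-rec D k) ⟩
    re D (alphaS D k ⊕ scale (u D (suc k)) (alphaS D (suc k)))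
                                                      ≡⟨ re-⊕ D (alphaS D k) _ ⟩
    V (suc k) ⊞ re D (scale (u D (suc k)) (alphaS D (suc k)))
                                                      ≡⟨ cong (V (suc k) ⊞_) (re-scale D (u D (suc k)) (alphaS D (suc k))) ⟩
    V (suc k) ⊞ + u D (suc k) ⊛ V (suc (suc k))       ≡⟨ ⊞-comm (V (suc k)) _ ⟩
    + u D (suc k) ⊛ V (suc (suc k)) ⊞ V (suc k)       ≡⟨ cong (λ c → c ⊛ V (suc (suc k)) ⊞ V (suc k)) (u≡a (suc k)) ⟩
    cfA D (suc k) ⊛ V (suc (suc k)) ⊞ V (suc k)       ∎
    where open ≡-Reasoning

  ρ : ℤ → Surd
  ρ p = ℤ.- p , + 1

  complete-quotient : ∀ k → Q k ⊛ V k ≡ mul D (ρ (P k)) (V (suc k))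
  complete-quotient zero = cong₂ _,_ (trans (X-base (e D) (+ D)) idempotent) (trans (Y-base (e D) (+ D)) idempotent)
    where
    idempotent : ∀ {r} → r ℤ.+ (e D ℤ.- e D ℤ.* e D) ≡ r
    idempotent {r} = trans (cong (λ t → r ℤ.+ (e D ℤ.- t)) e-idempotent)
                           (trans (cong (λ t → r ℤ.+ t) (ℤ.+-inverseʳ (e D))) (ℤ.+-identityʳ r))
    X-base : ∀ ε d → (+ 1 ℤ.+ ε) ℤ.* (+ 2 ℤ.* ℤ.- ε ℤ.+ ε ℤ.* + 1)
                   ≡ ℤ.- ε ℤ.* (+ 2 ℤ.* (+ 1 ℤ.- ε ℤ.* + 0) ℤ.+ ε ℤ.* + 0) ℤ.+ d ℤ.* (+ 1 ℤ.* ((+ 2 ℤ.- ε) ℤ.* + 0))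
                     ℤ.+ (ε ℤ.- ε ℤ.* ε)
    X-base = ℤ-Solver.solve-∀
    Y-base : ∀ ε d → (+ 1 ℤ.+ ε) ℤ.* ((+ 2 ℤ.- ε) ℤ.* + 1)
                   ≡ ℤ.- ε ℤ.* ((+ 2 ℤ.- ε) ℤ.* + 0) ℤ.+ + 1 ℤ.* (+ 2 ℤ.* (+ 1 ℤ.- ε ℤ.* + 0) ℤ.+ ε ℤ.* + 0)
                     ℤ.+ (ε ℤ.- ε ℤ.* ε)
    Y-base = ℤ-Solver.solve-∀
  complete-quotient (suc k) = sym (Q-⊛-cancel k (begin
    Q k ⊛ mul D (ρ P′) (V (suc (suc k)))                       ≡⟨ cong (λ t → Q k ⊛ mul D (ρ P′) t) (V-rec k) ⟩
    Q k ⊛ mul D (ρ P′) (c ⊛ V (suc k) ⊞ V k)                   ≡⟨ distribute (Q k) P′ c (V (suc k)) (V k) ⟩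
    mul D (ρ P′) ((c ℤ.* Q k) ⊛ V (suc k) ⊞ Q k ⊛ V k)         ≡⟨ cong (λ t → mul D (ρ P′) ((c ℤ.* Q k) ⊛ V (suc k) ⊞ t))
                                                                        (complete-quotient k) ⟩
    mul D (ρ P′) ((c ℤ.* Q k) ⊛ V (suc k) ⊞ mul D (ρ (P k)) (V (suc k)))
                                                               ≡⟨ conjugate-product c (Q k) (P k) (V (suc k)) ⟩
    (+ D ℤ.- P′ ℤ.* P′) ⊛ V (suc k)                            ≡⟨ cong (_⊛ V (suc k)) (Q-step k) ⟨
    (Q k ℤ.* Q (suc k)) ⊛ V (suc k)                            ≡⟨ ⊛-assoc (Q k) (Q (suc k)) (V (suc k)) ⟩
    Q k ⊛ (Q (suc k) ⊛ V (suc k))                              ∎))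
    where
    open ≡-Reasoning
    c = cfA D k
    P′ = P (suc k)
    distribute : ∀ Q p c v w → Q ⊛ mul D (ρ p) (c ⊛ v ⊞ w) ≡ mul D (ρ p) ((c ℤ.* Q) ⊛ v ⊞ Q ⊛ w)
    distribute Q p c (x , y) (x′ , y′) = cong₂ _,_ (first Q p c x y x′ y′ (+ D)) (second Q p c x y x′ y′)
      where
      first : ∀ Q p c x y x′ y′ d → Q ℤ.* (ℤ.- p ℤ.* (c ℤ.* x ℤ.+ x′) ℤ.+ d ℤ.* (+ 1 ℤ.* (c ℤ.* y ℤ.+ y′)))
                                    ≡ ℤ.- p ℤ.* (c ℤ.* Q ℤ.* x ℤ.+ Q ℤ.* x′) ℤ.+ d ℤ.* (+ 1 ℤ.* (c ℤ.* Q ℤ.* y ℤ.+ Q ℤ.* y′))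
      first = ℤ-Solver.solve-∀
      second : ∀ Q p c x y x′ y′ → Q ℤ.* (ℤ.- p ℤ.* (c ℤ.* y ℤ.+ y′) ℤ.+ + 1 ℤ.* (c ℤ.* x ℤ.+ x′))
                                   ≡ ℤ.- p ℤ.* (c ℤ.* Q ℤ.* y ℤ.+ Q ℤ.* y′) ℤ.+ + 1 ℤ.* (c ℤ.* Q ℤ.* x ℤ.+ Q ℤ.* x′)
      second = ℤ-Solver.solve-∀
    -- (√D − R)(R + √D) = D − R² with R = c Q − p
    conjugate-product : ∀ c Q p v → mul D (ρ (c ℤ.* Q ℤ.- p)) ((c ℤ.* Q) ⊛ v ⊞ mul D (ρ p) v)
                                    ≡ (+ D ℤ.- (c ℤ.* Q ℤ.- p) ℤ.* (c ℤ.* Q ℤ.- p)) ⊛ v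
    conjugate-product c Q p (x , y) = cong₂ _,_ (first c Q p x y (+ D)) (second c Q p x y (+ D))
      where
      first : ∀ c Q p x y d → ℤ.- (c ℤ.* Q ℤ.- p) ℤ.* (c ℤ.* Q ℤ.* x ℤ.+ (ℤ.- p ℤ.* x ℤ.+ d ℤ.* (+ 1 ℤ.* y)))
                                ℤ.+ d ℤ.* (+ 1 ℤ.* (c ℤ.* Q ℤ.* y ℤ.+ (ℤ.- p ℤ.* y ℤ.+ + 1 ℤ.* x)))
                              ≡ (d ℤ.- (c ℤ.* Q ℤ.- p) ℤ.* (c ℤ.* Q ℤ.- p)) ℤ.* x
      first = ℤ-Solver.solve-∀
      second : ∀ c Q p x y d → ℤ.- (c ℤ.* Q ℤ.- p) ℤ.* (c ℤ.* Q ℤ.* y ℤ.+ (ℤ.- p ℤ.* y ℤ.+ + 1 ℤ.* x))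
                                 ℤ.+ + 1 ℤ.* (c ℤ.* Q ℤ.* x ℤ.+ (ℤ.- p ℤ.* x ℤ.+ d ℤ.* (+ 1 ℤ.* y)))
                               ≡ (d ℤ.- (c ℤ.* Q ℤ.- p) ℤ.* (c ℤ.* Q ℤ.- p)) ℤ.* y
      second = ℤ-Solver.solve-∀

  private
    neg-pos : ∀ {z} → + 0 ℤ.< ℤ.- z → z ℤ.< + 0
    neg-pos {z} 0<-z = subst (ℤ._< + 0) (ℤ.neg-involutive z) (ℤ.neg-mono-< 0<-z)

    neg-neg : ∀ {z} → ℤ.- z ℤ.< + 0 → + 0 ℤ.< z
    neg-neg {z} -z<0 = subst (+ 0 ℤ.<_) (ℤ.neg-involutive z) (ℤ.neg-mono-< -z<0)

    *-pos-pos : ∀ q {x} → + 0 ℤ.< x → + 0 ℤ.< + suc q ℤ.* x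
    *-pos-pos q {x} 0<x = subst (ℤ._< + suc q ℤ.* x) (ℤ.*-zeroʳ (+ suc q)) (ℤ.*-monoˡ-<-pos (+ suc q) 0<x)

    *-pos-neg : ∀ q {x} → x ℤ.< + 0 → + suc q ℤ.* x ℤ.< + 0
    *-pos-neg q {x} x<0 = subst (+ suc q ℤ.* x ℤ.<_) (ℤ.*-zeroʳ (+ suc q)) (ℤ.*-monoˡ-<-pos (+ suc q) x<0)

    *-pos-pos⁻¹ : ∀ q {x} → + 0 ℤ.< + suc q ℤ.* x → + 0 ℤ.< x
    *-pos-pos⁻¹ q {x} 0<qx = ℤ.*-cancelˡ-<-nonNeg (+ suc q) (subst (ℤ._< + suc q ℤ.* x) (sym (ℤ.*-zeroʳ (+ suc q))) 0<qx)

    *-pos-neg⁻¹ : ∀ q {x} → + suc q ℤ.* x ℤ.< + 0 → x ℤ.< + 0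
    *-pos-neg⁻¹ q {x} qx<0 = ℤ.*-cancelˡ-<-nonNeg (+ suc q) (subst (+ suc q ℤ.* x ℤ.<_) (sym (ℤ.*-zeroʳ (+ suc q))) qx<0)

    0<⇒suc : ∀ {x} → + 0 ℤ.< x → Σ ℕ λ n → x ≡ + suc n
    0<⇒suc (+<+ {n = suc n} _) = n , refl

  N : ℕ → ℤ
  N k = norm D (V k)

  private
    norm-ρ : ∀ p → norm D (ρ p) ≡ ℤ.- (+ D ℤ.- p ℤ.* p)
    norm-ρ p = shape p (+ D)
      where
      shape : ∀ p d → ℤ.- p ℤ.* ℤ.- p ℤ.- d ℤ.* (+ 1 ℤ.* + 1) ≡ ℤ.- (d ℤ.- p ℤ.* p)
      shape = ℤ-Solver.solve-∀

  norm-step : ∀ k → Q (suc k) ℤ.* N (suc k) ≡ ℤ.- (Q k ℤ.* N (suc (suc k)))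
  norm-step k = Q-cancel (suc k) (begin
      Q′ ℤ.* (Q′ ℤ.* N (suc k))                  ≡⟨ ℤ.*-assoc Q′ Q′ (N (suc k)) ⟨
      Q′ ℤ.* Q′ ℤ.* N (suc k)                    ≡⟨ norm-⊛ D Q′ (V (suc k)) ⟨
      norm D (Q′ ⊛ V (suc k))                    ≡⟨ cong (norm D) (complete-quotient (suc k)) ⟩
      norm D (mul D (ρ P′) (V (suc (suc k))))     ≡⟨ norm-mul D (ρ P′) (V (suc (suc k))) ⟩
      norm D (ρ P′) ℤ.* N (suc (suc k))           ≡⟨ cong (ℤ._* N (suc (suc k))) (trans (norm-ρ P′) (cong ℤ.-_ (sym (Q-step k)))) ⟩
      ℤ.- (Q k ℤ.* Q′) ℤ.* N (suc (suc k))        ≡⟨ regroup (Q k) Q′ (N (suc (suc k))) ⟩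
      Q′ ℤ.* ℤ.- (Q k ℤ.* N (suc (suc k)))        ∎)
    where
    open ≡-Reasoning
    Q′ = Q (suc k)
    P′ = P (suc k)
    regroup : ∀ a b n → ℤ.- (a ℤ.* b) ℤ.* n ≡ b ℤ.* ℤ.- (a ℤ.* n)
    regroup = ℤ-Solver.solve-∀

  norm-flip : ∀ k → (+ 0 ℤ.< N (suc k) → N (suc (suc k)) ℤ.< + 0)
                  × (N (suc k) ℤ.< + 0 → + 0 ℤ.< N (suc (suc k)))
  norm-flip k with Invariant.Q≡1+q (invariant k) | Invariant.Q≡1+q (invariant (suc k))
  ... | q , Qk≡ | q′ , Q′≡ =
      (λ 0<N → *-pos-neg⁻¹ q (neg-pos (subst (+ 0 ℤ.<_) step′ (*-pos-pos q′ 0<N))))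
    , (λ N<0 → *-pos-pos⁻¹ q (neg-neg (subst (ℤ._< + 0) step′ (*-pos-neg q′ N<0))))
    where
    step′ : + suc q′ ℤ.* N (suc k) ≡ ℤ.- (+ suc q ℤ.* N (suc (suc k)))
    step′ = subst₂ (λ a b → a ℤ.* N (suc k) ≡ ℤ.- (b ℤ.* N (suc (suc k)))) Q′≡ Qk≡ (norm-step k)

  norm-V₁ : + 0 ℤ.< N 1
  norm-V₁ = subst (+ 0 ℤ.<_) (sym (four (e D) (+ D))) (+<+ (s≤s z≤n))
    where
    four : ∀ ε d → (+ 2 ℤ.* (+ 1 ℤ.- ε ℤ.* + 0) ℤ.+ ε ℤ.* + 0) ℤ.* (+ 2 ℤ.* (+ 1 ℤ.- ε ℤ.* + 0) ℤ.+ ε ℤ.* + 0)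
                   ℤ.- d ℤ.* ((+ 2 ℤ.- ε) ℤ.* + 0 ℤ.* ((+ 2 ℤ.- ε) ℤ.* + 0)) ≡ + 4
    four = ℤ-Solver.solve-∀

  norm-signs : ∀ m → + 0 ℤ.< N (suc (2 * m)) × N (suc (suc (2 * m))) ℤ.< + 0
  norm-signs zero    = norm-V₁ , proj₁ (norm-flip 0) norm-V₁
  norm-signs (suc m) = subst (λ t → + 0 ℤ.< N (suc t) × N (suc (suc t)) ℤ.< + 0) (sym (ℕ.*-suc 2 m))
                         (N>0 , proj₁ (norm-flip (suc (suc (2 * m)))) N>0)
    where
    N>0 = proj₂ (norm-flip (suc (2 * m))) (proj₂ (norm-signs m))

  V-pos : ∀ k → IsPos D (V k)
  V-pos zero with e-cases
  ... | inj₁ e≡0       rewrite e≡0 = s≤s z≤n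
  ... | inj₂ (e≡1 , _) rewrite e≡1 = sqrtLess (subst (1 <_) (sym (ℕ.+-identityʳ D)) 2≤D)
  V-pos (suc zero) with e-cases
  ... | inj₁ e≡0       rewrite e≡0 = s≤s z≤n
  ... | inj₂ (e≡1 , _) rewrite e≡1 = s≤s z≤n
  V-pos (suc (suc k)) = subst (IsPos D) (sym (trans (V-rec k) (cong (λ c → c ⊛ V (suc k) ⊞ V k) a≡1+n)))
                          (IsPos-⊞ (IsPos-⊛ n (V-pos (suc k))) (V-pos k))
    where
    n = proj₁ (1≤⇒suc (a≥1 k))
    a≡1+n = proj₂ (1≤⇒suc (a≥1 k))

  -- α_{k} − α_{k-1} = (a_k − 1) α_{k-1} + α_{k-2}
  V-increasing : ∀ k → IsPos D (V (suc (suc k)) ⊞ ⊟ V (suc k))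
  V-increasing k with 1≤⇒suc (a≥1 k)
  ... | n , a≡1+n = subst (IsPos D) (sym eq) (NonNeg-⊞-IsPos (NonNeg-⊛ n (V-pos (suc k))) (V-pos k))
    where
    eq : V (suc (suc k)) ⊞ ⊟ V (suc k) ≡ + n ⊛ V (suc k) ⊞ V k
    eq = trans (cong (_⊞ ⊟ V (suc k)) (trans (V-rec k) (cong (λ c → c ⊛ V (suc k) ⊞ V k) a≡1+n)))
               (cong₂ _,_ (drop-one (+ n) (proj₁ (V (suc k))) (proj₁ (V k)))
                          (drop-one (+ n) (proj₂ (V (suc k))) (proj₂ (V k))))
      where
      drop-one : ∀ n x y → (+ 1 ℤ.+ n) ℤ.* x ℤ.+ y ℤ.+ ℤ.- x ≡ n ℤ.* x ℤ.+ y
      drop-one = ℤ-Solver.solve-∀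

  P-Q-square : ∀ j → (P j ℤ.- Q j) ℤ.* (P j ℤ.- Q j) ℤ.< + D
  P-Q-square j = small-square (P j ℤ.- Q j) (≤-by _ (0≤-of-≤ Q≤P+G) (lower (P j) (Q j) G))
                   (≤-by _ (0≤-+ (0≤-of-≤ P≤G) (subst (+ 0 ℤ.≤_) (sym (proj₂ Q≡1+q)) (+≤+ z≤n))) (upper (P j) (Q j) G))
    where
    open Invariant (invariant j)
    lower : ∀ p q g → p ℤ.+ g ℤ.- q ≡ p ℤ.- q ℤ.- ℤ.- g
    lower = ℤ-Solver.solve-∀
    upper : ∀ p q g → g ℤ.- p ℤ.+ q ≡ g ℤ.- (p ℤ.- q)
    upper = ℤ-Solver.solve-∀

  -- Q_j (α_{j-2} + α_{j-1}) = (√D − P_j + Q_j) α_{j-1}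
  norm-sum-scaled : ∀ j → Q j ℤ.* (Q j ℤ.* norm D (V j ⊞ V (suc j))) ≡ norm D (ρ (P j ℤ.- Q j)) ℤ.* N (suc j)
  norm-sum-scaled j = begin
    Q j ℤ.* (Q j ℤ.* norm D (V j ⊞ V (suc j)))          ≡⟨ ℤ.*-assoc (Q j) (Q j) _ ⟨
    Q j ℤ.* Q j ℤ.* norm D (V j ⊞ V (suc j))            ≡⟨ norm-⊛ D (Q j) (V j ⊞ V (suc j)) ⟨
    norm D (Q j ⊛ (V j ⊞ V (suc j)))                    ≡⟨ cong (norm D) (⊛-distrib-⊞ (Q j) (V j) (V (suc j))) ⟩
    norm D (Q j ⊛ V j ⊞ Q j ⊛ V (suc j))                ≡⟨ cong (λ t → norm D (t ⊞ Q j ⊛ V (suc j))) (complete-quotient j) ⟩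
    norm D (mul D (ρ (P j)) (V (suc j)) ⊞ Q j ⊛ V (suc j)) ≡⟨ cong (norm D) (shift-ρ (P j) (Q j) (V (suc j))) ⟩
    norm D (mul D (ρ (P j ℤ.- Q j)) (V (suc j)))        ≡⟨ norm-mul D (ρ (P j ℤ.- Q j)) (V (suc j)) ⟩
    norm D (ρ (P j ℤ.- Q j)) ℤ.* N (suc j)              ∎
    where
    open ≡-Reasoning
    shift-ρ : ∀ p q v → mul D (ρ p) v ⊞ q ⊛ v ≡ mul D (ρ (p ℤ.- q)) v
    shift-ρ p q (x , y) = cong₂ _,_ (first p q x y (+ D)) (second p q x y)
      where
      first : ∀ p q x y d → ℤ.- p ℤ.* x ℤ.+ d ℤ.* (+ 1 ℤ.* y) ℤ.+ q ℤ.* x ≡ ℤ.- (p ℤ.- q) ℤ.* x ℤ.+ d ℤ.* (+ 1 ℤ.* y)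
      first = ℤ-Solver.solve-∀
      second : ∀ p q x y → ℤ.- p ℤ.* y ℤ.+ + 1 ℤ.* x ℤ.+ q ℤ.* y ≡ ℤ.- (p ℤ.- q) ℤ.* y ℤ.+ + 1 ℤ.* x
      second = ℤ-Solver.solve-∀

  norm-sum : ∀ j → + 0 ℤ.< N (suc j) → norm D (V j ⊞ V (suc j)) ℤ.< + 0
  norm-sum j N>0 with Invariant.Q≡1+q (invariant j) | 0<⇒suc N>0
  ... | q , Qj≡1+q | n , N≡1+n =
    *-pos-neg⁻¹ q (*-pos-neg⁻¹ q (subst (λ c → c ℤ.* (c ℤ.* norm D (V j ⊞ V (suc j))) ℤ.< + 0) Qj≡1+q
                                    (subst (ℤ._< + 0) (sym (norm-sum-scaled j)) product<0)))
    where
    z = P j ℤ.- Q j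
    product<0 : norm D (ρ z) ℤ.* N (suc j) ℤ.< + 0
    product<0 = subst (ℤ._< + 0) (trans (ℤ.*-comm (+ suc n) (norm D (ρ z))) (cong (norm D (ρ z) ℤ.*_) (sym N≡1+n)))
                  (*-pos-neg n (subst (ℤ._< + 0) (sym (norm-ρ z)) (ℤ.neg-mono-< (0<-of-< (P-Q-square j)))))

convergent-det : ℕ → ℕ → ℤ
convergent-det D n = pS D n ℤ.* qS D (suc n) ℤ.- pS D (suc n) ℤ.* qS D n

convergent-det-even : ∀ D m → convergent-det D (2 * m) ≡ + 1
convergent-det-even D zero    = base (cfA D 0)
  where
  base : ∀ a → + 1 ℤ.* + 1 ℤ.- a ℤ.* + 0 ≡ + 1
  base = ℤ-Solver.solve-∀
convergent-det-even D (suc m) = begin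
  convergent-det D (2 * suc m)               ≡⟨ cong (convergent-det D) (ℕ.*-suc 2 m) ⟩
  convergent-det D (suc (suc (2 * m)))       ≡⟨ flip (suc (2 * m)) ⟩
  ℤ.- convergent-det D (suc (2 * m))         ≡⟨ cong ℤ.-_ (flip (2 * m)) ⟩
  ℤ.- ℤ.- convergent-det D (2 * m)           ≡⟨ ℤ.neg-involutive _ ⟩
  convergent-det D (2 * m)                   ≡⟨ convergent-det-even D m ⟩
  + 1                                        ∎
  where
  open ≡-Reasoning
  flip : ∀ n → convergent-det D (suc n) ≡ ℤ.- convergent-det D n
  flip n = alternate (+ u D (suc n)) (pS D (suc n)) (pS D n) (qS D (suc n)) (qS D n)
    where
    alternate : ∀ c p₁ p₀ q₁ q₀ → p₁ ℤ.* (c ℤ.* q₁ ℤ.+ q₀) ℤ.- (c ℤ.* p₁ ℤ.+ p₀) ℤ.* q₁ ≡ ℤ.- (p₀ ℤ.* q₁ ℤ.- p₁ ℤ.* q₀)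
    alternate = ℤ-Solver.solve-∀

alphaS-det : ∀ D m → a (alphaS D (2 * m)) ℤ.* b (alphaS D (suc (2 * m)))
                     ℤ.- a (alphaS D (suc (2 * m))) ℤ.* b (alphaS D (2 * m)) ≡ + 1
alphaS-det D m = trans (shear (pS D (2 * m)) (qS D (2 * m)) (pS D (suc (2 * m))) (qS D (suc (2 * m))) (e D))
                       (convergent-det-even D m)
  where
  shear : ∀ p₀ q₀ p₁ q₁ ε → (p₀ ℤ.- ε ℤ.* q₀) ℤ.* q₁ ℤ.- (p₁ ℤ.- ε ℤ.* q₁) ℤ.* q₀ ≡ p₀ ℤ.* q₁ ℤ.- p₁ ℤ.* q₀
  shear = ℤ-Solver.solve-∀

module Semiconvergents (D : ℕ) (2≤D : 2 ≤ D) (sf : SquareFree D) (m : ℕ) where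

  open ContinuedFraction D 2≤D sf

  A B C : OK
  A = alphaS D (2 * m)
  B = alphaS D (suc (2 * m))
  C = alphaS D (suc (suc (2 * m)))

  u₁ : ℕ
  u₁ = u D (suc (2 * m))

  private
    -- V i, V (suc i) and V (suc (suc i)) are the real embeddings of A, B and C
    i = suc (2 * m)

    N-A>0 : + 0 ℤ.< N i
    N-A>0 = proj₁ (norm-signs m)

    N-B<0 : N (suc i) ℤ.< + 0
    N-B<0 = proj₂ (norm-signs m)

    N-C>0 : + 0 ℤ.< N (suc (suc i))
    N-C>0 = proj₂ (norm-flip i) N-B<0

    C≡ : A ⊕ scale u₁ B ≡ C
    C≡ = sym (alphaS-rec D (2 * m))

    C⁺≡ : A ⊕ scale (suc u₁) B ≡ B ⊕ C
    C⁺≡ = trans (cong₂ ⟨_,_⟩ (peel (a A) (a B) (+ u₁)) (peel (b A) (b B) (+ u₁))) (cong (B ⊕_) C≡)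
      where
      peel : ∀ p q c → p ℤ.+ (+ 1 ℤ.+ c) ℤ.* q ≡ q ℤ.+ (p ℤ.+ c ℤ.* q)
      peel = ℤ-Solver.solve-∀

    A′>0 : ConjPos D A
    A′>0 = conj-IsPos (V-pos i) N-A>0

    B′<0 : IsPos D (⊟ conj (re D B))
    B′<0 = ⊟conj-IsPos (V-pos (suc i)) N-B<0

    C′>0 : ConjPos D (A ⊕ scale u₁ B)
    C′>0 = subst (ConjPos D) (sym C≡) (conj-IsPos (V-pos (suc (suc i))) N-C>0)

    C⁺′<0 : IsPos D (⊟ conj (re D (A ⊕ scale (suc u₁) B)))
    C⁺′<0 = subst (λ γ → IsPos D (⊟ conj (re D γ))) (sym C⁺≡)
              (subst (λ v → IsPos D (⊟ conj v)) (sym (re-⊕ D B C))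
                (⊟conj-IsPos (IsPos-⊞ (V-pos (suc i)) (V-pos (suc (suc i)))) (norm-sum (suc i) N-C>0)))

  open Cone D A B u₁ (alphaS-det D m) (V-pos i) A′>0 (V-increasing (2 * m)) B′<0 C′>0 C⁺′<0 public

∸-suc : ∀ {m n} → n < m → m ∸ n ≡ suc (m ∸ suc n)
∸-suc {suc m} {zero}  _         = refl
∸-suc {suc m} {suc n} (s≤s n<m) = ∸-suc n<m

⊓-shift : ∀ k m n → (m + k) ⊓ (n + k) ≡ k + m ⊓ n
⊓-shift k m n = trans (sym (ℕ.+-distribʳ-⊓ k m n)) (ℕ.+-comm (m ⊓ n) k)

proposition3p4 : (D : ℕ) → 2 ≤ D → SquareFree D →
    (m r : ℕ) → r < u D (suc (2 * m)) →
    (β⁺ : OK) → IsNextIndec D (alphaIR D m r) β⁺ →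
      pKI D (alphaIR D m r ⊕ alphaIR D m r) ((r + 1) ⊓ (u D (suc (2 * m)) ∸ r + 1))
    × pKI D (alphaIR D m r ⊕ β⁺) ((r + 1) ⊓ (u D (suc (2 * m)) ∸ r))
    × pK D (alphaIR D m r ⊕ alphaIR D m r) ((r + 2) ⊓ (u D (suc (2 * m)) ∸ r + 2))
    × pK D (alphaIR D m r ⊕ β⁺) ((r + 2) ⊓ (u D (suc (2 * m)) ∸ r + 1))
proposition3p4 D 2≤D sf m r r<u β⁺ next =
    subst (pKI D (elt r ⊕ elt r)) (sym (⊓-shift 1 r (u₁ ∸ r))) (Count.count-Indec r r ℕ.≤-refl (ℕ.n≤1+n r) r≤u)
  , subst₂ (pKI D) sum≡ (sym (trans (cong ((r + 1) ⊓_) u₁∸r≡) (⊓-shift 1 r (u₁ ∸ suc r))))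
      (Count.count-Indec r (suc r) (ℕ.n≤1+n r) ℕ.≤-refl r<u)
  , subst (pK D (elt r ⊕ elt r)) (sym (⊓-shift 2 r (u₁ ∸ r))) (Count.count r r ℕ.≤-refl (ℕ.n≤1+n r) r≤u)
  , subst₂ (pK D) sum≡ (sym (trans (cong ((r + 2) ⊓_) u₁∸r+1≡) (⊓-shift 2 r (u₁ ∸ suc r))))
      (Count.count r (suc r) (ℕ.n≤1+n r) ℕ.≤-refl r<u)
  where
  open Semiconvergents D 2≤D sf m
  r≤u = ℕ.<⇒≤ r<u
  u₁∸r≡ : u₁ ∸ r ≡ u₁ ∸ suc r + 1
  u₁∸r≡ = trans (∸-suc r<u) (ℕ.+-comm 1 (u₁ ∸ suc r))
  u₁∸r+1≡ : u₁ ∸ r + 1 ≡ u₁ ∸ suc r + 2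
  u₁∸r+1≡ = trans (cong (_+ 1) (∸-suc r<u)) (sym (ℕ.+-suc (u₁ ∸ suc r) 1))
  sum≡ : elt r ⊕ elt (suc r) ≡ elt r ⊕ β⁺
  sum≡ = cong (elt r ⊕_) (sym (elt-successor r r<u β⁺ next))
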